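{- Let $X$ be an irreducible shift space which is eventually dendric with threshold $m$. Then for every $w\in\mathcal L(X)$ the set $\mathcal R_X(w)$ is finite. Moreover, for every $w\in\mathcal L_{\ge m}(X)$, $\mathrm{Card}(\mathcal R_X(w))=1+\rho_X(\mathcal L_m(X))$.
   Context: A shift space on a finite alphabet $A$ is a closed shift-invariant subset of $A^{\mathbb Z}$; $\mathcal L(X)$ is its set of finite factors (including the empty word), $\mathcal L_m(X)$ those of length $m$, $\mathcal L_{\ge m}(X)$ those of length at least $m$. $X$ is irreducible if for all $u,v\in\mathcal L(X)$ there is $w$ with $uwv\in\mathcal L(X)$. For $w\in\mathcal L(X)$, $\mathcal E_1(w)$ is the undirected bipartite graph with vertex set the disjoint union of $L_1(w)=\{a\in A:aw\in\mathcal L(X)\}$ and $R_1(w)=\{b\in A:wb\in\mathcal L(X)\}$ and edges the pairs $(a,b)$ with $awb\in\mathcal L(X)$; $X$ is eventually dendric with threshold $m$ if $\mathcal E_1(w)$ is a tree for all $w\in\mathcal L_{\ge m}(X)$. A complete return word to $w$ is a word of $\mathcal L(X)$ having exactly two factors (occurrences) equal to $w$, one as a proper prefix and one as a proper suffix; if $wu$ is a complete return word to $w$, then $u$ is a return word to $w$, and $\mathcal R_X(w)$ is the set of return words to $w$. For $w\in\mathcal L(X)$ set $\rho_X(w)=\mathrm{Card}(R_1(w))-1$, and for $W\subset\mathcal L(X)$, $\rho_X(W)=\sum_{w\in W}\rho_X(w)$. -}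

module Defs where

open import Data.Nat using (ℕ; zero; suc; _+_; _*_; _∸_; _≤_; _<_)
open import Data.Integer using (ℤ; +_; -_) renaming (_+_ to _+ℤ_)
open import Data.Fin using (Fin)
open import Data.List using (List; []; _∷_; _++_; [_]; length; take; drop; map)
open import Data.Nat.ListAction using (sum)
open import Data.List.Membership.Propositional using (_∈_)
open import Data.List.Relation.Unary.Unique.Propositional using (Unique)
open import Data.List.Relation.Unary.Linked using (Linked)
open import Data.List.Relation.Binary.Pointwise using (Pointwise)
open import Data.Sum using (_⊎_; inj₁; inj₂)
open import Data.Product using (Σ; ∃; ∃-syntax; _×_; _,_)
open import Data.Empty using (⊥)
open import Relation.Nullary using (¬_)
open import Relation.Binary.PropositionalEquality using (_≡_)

Seq : ℕ → Set
Seq k = ℤ → Fin k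

Word : ℕ → Set
Word k = List (Fin k)

window : ∀ {k} → Seq k → ℤ → ℕ → Word k
window x i zero    = []
window x i (suc n) = x i ∷ window x (i +ℤ + 1) n

shift : ∀ {k} → Seq k → Seq k
shift x i = x (i +ℤ + 1)

record ShiftSpace (k : ℕ) : Set₁ where
  field
    X : Seq k → Set
    shift-inv₁ : ∀ x → X x → X (shift x)
    shift-inv₂ : ∀ x → X (shift x) → X x
    -- closed in the product topology: a sequence all of whose central
    -- windows x_[-n,n] agree with those of points of X lies in X
    closed : ∀ x → (∀ n → ∃[ y ] (X y × window x (- (+ n)) (suc (n + n)) ≡ window y (- (+ n)) (suc (n + n)))) → X x

module _ {k : ℕ} (S : ShiftSpace k) where
  open ShiftSpace S

  Lang : Word k → Set
  Lang w = ∃[ x ] (X x × ∃[ i ] (window x i (length w) ≡ w))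

  Lang= : ℕ → Word k → Set
  Lang= m w = Lang w × length w ≡ m

  Irreducible : Set
  Irreducible = ∀ u v → Lang u → Lang v → ∃[ w ] Lang (u ++ w ++ v)

  L₁ : Word k → Fin k → Set
  L₁ w a = Lang (a ∷ w)

  R₁ : Word k → Fin k → Set
  R₁ w b = Lang (w ++ [ b ])

  -- extension graph E₁(w): vertices inj₁ a (a ∈ L₁ w), inj₂ b (b ∈ R₁ w)
  Vert : Word k → Fin k ⊎ Fin k → Set
  Vert w (inj₁ a) = L₁ w a
  Vert w (inj₂ b) = R₁ w b

  Adj : Word k → Fin k ⊎ Fin k → Fin k ⊎ Fin k → Set
  Adj w (inj₁ a) (inj₂ b) = Lang (a ∷ w ++ [ b ])
  Adj w (inj₂ b) (inj₁ a) = Lang (a ∷ w ++ [ b ])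
  Adj w (inj₁ _) (inj₁ _) = ⊥
  Adj w (inj₂ _) (inj₂ _) = ⊥

  Walk : Word k → Fin k ⊎ Fin k → Fin k ⊎ Fin k → Set
  Walk w u v = ∃[ vs ] (Linked (Adj w) (u ∷ vs ++ [ v ]))

  Connected : Word k → Set
  Connected w = ∀ u v → Vert w u → Vert w v → (u ≡ v) ⊎ Walk w u v

  Cycle : Word k → Set
  Cycle w = Σ (Fin k ⊎ Fin k) λ v₀ → Σ (List (Fin k ⊎ Fin k)) λ vs →
              (3 ≤ length (v₀ ∷ vs)) × Unique (v₀ ∷ vs) × Linked (Adj w) (v₀ ∷ vs ++ [ v₀ ])

  IsTree : Word k → Set
  IsTree w = Connected w × ¬ Cycle w

  EventuallyDendric : ℕ → Set
  EventuallyDendric m = ∀ w → Lang w → m ≤ length w → IsTree w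

  OccursAt : Word k → Word k → ℕ → Set
  OccursAt w u i = (i + length w ≤ length u) × (take (length w) (drop i u) ≡ w)

  CompleteReturn : Word k → Word k → Set
  CompleteReturn w u = Lang u × length w < length u
                     × OccursAt w u 0 × OccursAt w u (length u ∸ length w)
                     × (∀ i → OccursAt w u i → (i ≡ 0) ⊎ (i ≡ length u ∸ length w))

  Return : Word k → Word k → Set
  Return w u = CompleteReturn w (w ++ u)

HasCard : {T : Set} → (T → Set) → ℕ → Set
HasCard {T} P n = ∃[ ls ] (Unique ls × (∀ t → (P t → t ∈ ls) × (t ∈ ls → P t)) × length ls ≡ n)

Finite : {T : Set} → (T → Set) → Set
Finite P = ∃[ n ] HasCard P n

IsRhoLm : ∀ {k} → ShiftSpace k → ℕ → ℕ → Set
IsRhoLm {k} S m r = Σ (List (Word k)) λ ls → Σ (List ℕ) λ ns →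
  (∀ t → (Lang= S m t → t ∈ ls) × (t ∈ ls → Lang= S m t)) × Unique ls ×
  Pointwise (λ u n → HasCard (R₁ S u) n) ls ns ×
  r ≡ sum (map (λ n → n ∸ 1) ns)

module Submission where

-- All counting is classical: the statement supplies excluded middle LEM, and
-- we count with indicators ind P ∈ {0,1} summed over the finite sets of words
-- of a fixed length.
--  * Tree count (tree-count).  A finite tree has one vertex more than it has
--    edges: orient every edge towards a root; every vertex but the root has a
--    unique parent.  For the extension graph of v with |v| ≥ m this gives
--    Σ_a ρ(av) = ρ(v) (ρ-additive), so P N = Σ_{|z|=N} ρ(z) is constant for
--    N ≥ m (P-constant), and P m = ρ(L_m(X)).
--  * Levels of return words (step-count, level).  Fix w = c w'.  Call u
--    pending if wu ∈ L(X) contains w only as a prefix.  For every letter b,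
--    either ub is a return word, or ub is pending, or wub ∉ L(X).  Summing
--    over b and over |u| = i telescopes to Card R(w) = 1 + Σ_i PendingMass i,
--    where PendingMass i sums ρ(wu) over the pending u of length i.
--  * Σ_i PendingMass i = P m (pending-mass-total): long pending words have a
--    unique right extension, so by irreducibility pending words are short and
--    every long factor contains w (long-factors-contain); then the ρ-mass of
--    the words containing w, which grows by PendingMass at each length,
--    exhausts P N.
--  * Finiteness for |w| < m follows by padding w to a word of length ≥ m.

open import Defs
open import Data.Nat using (ℕ; zero; suc; _+_; _*_; _∸_; _≤_; _<_; z≤n; s≤s; _≤?_)
open import Data.Nat.Properties
open import Data.Nat.ListAction using (sum)
open import Data.Nat.Tactic.RingSolver using (solve-∀)
import Data.Integer as ℤ
import Data.Integer.Properties as ℤP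
open import Data.Bool using (Bool; true; false; not)
open import Data.Bool.Properties using (not-involutive; not-¬)
open import Data.Fin using (Fin)
open import Data.List using (List; []; _∷_; _++_; [_]; length; map; allFin; take; drop; filter; cartesianProductWith; initLast; _∷ʳ′_)
open import Data.List.Properties using (length-++; ++-assoc; ++-identityʳ; take++drop≡id; drop-drop; length-drop; length-++-≤ˡ; length-++-≤ʳ; map-∘; ∷-injective; ∷-injectiveʳ)
open import Data.List.Membership.Propositional using (_∈_)
open import Data.List.Membership.Propositional.Properties using (∈-++⁻; ∈-++⁺ˡ; ∈-++⁺ʳ; ∈-allFin; ∈-filter⁺; ∈-filter⁻; ∈-cartesianProductWith⁺; ∈-cartesianProductWith⁻)
open import Data.List.Relation.Unary.Any using (here; there)
import Data.List.Relation.Unary.All as All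
open import Data.List.Relation.Unary.AllPairs using ([]; _∷_)
open import Data.List.Relation.Unary.Unique.Propositional using (Unique)
open import Data.List.Relation.Unary.Unique.Propositional.Properties using (allFin⁺; filter⁺; cartesianProductWith⁺; ++⁺)
open import Data.List.Relation.Unary.Linked using (Linked; [-]; _∷_)
open import Data.List.Relation.Binary.Pointwise using (Pointwise; []; _∷_)
open import Data.Product using (Σ; ∃-syntax; _×_; _,_; proj₁; proj₂)
open import Data.Sum using (_⊎_; inj₁; inj₂)
open import Data.Sum.Properties using (inj₁-injective; inj₂-injective)
open import Function using (_∘_)
open import Data.Empty using (⊥; ⊥-elim)
open import Relation.Nullary using (¬_; Dec; yes; no)
open import Relation.Binary.Definitions using (tri<; tri≈; tri>)
open import Relation.Binary.PropositionalEquality hiding ([_]; J)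

module Sums where

  interchange : ∀ a b c d → (a + b) + (c + d) ≡ (a + c) + (b + d)
  interchange = solve-∀

  right-comm : ∀ a b c → (a + b) + c ≡ (a + c) + b
  right-comm = solve-∀

  swap-inner : ∀ a b c → a + (b + c) ≡ (a + c) + b
  swap-inner = solve-∀

  module _ {A : Set} where

    Σl : List A → (A → ℕ) → ℕ
    Σl xs f = sum (map f xs)

    Σl-ext : ∀ xs {f g : A → ℕ} → (∀ x → f x ≡ g x) → Σl xs f ≡ Σl xs g
    Σl-ext []       e = refl
    Σl-ext (x ∷ xs) e = cong₂ _+_ (e x) (Σl-ext xs e)

    Σl-+ : ∀ xs (f g : A → ℕ) → Σl xs (λ x → f x + g x) ≡ Σl xs f + Σl xs g
    Σl-+ []       f g = refl
    Σl-+ (x ∷ xs) f g rewrite Σl-+ xs f g = interchange (f x) (g x) (Σl xs f) (Σl xs g)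

    Σl-++ : ∀ (xs ys : List A) f → Σl (xs ++ ys) f ≡ Σl xs f + Σl ys f
    Σl-++ []       ys f = refl
    Σl-++ (x ∷ xs) ys f = trans (cong (f x +_) (Σl-++ xs ys f)) (sym (+-assoc (f x) _ _))

    Σl-*ˡ : ∀ xs c (f : A → ℕ) → Σl xs (λ x → c * f x) ≡ c * Σl xs f
    Σl-*ˡ []       c f = sym (*-zeroʳ c)
    Σl-*ˡ (x ∷ xs) c f rewrite Σl-*ˡ xs c f = sym (*-distribˡ-+ c (f x) _)

    Σl-mono : ∀ xs {f g : A → ℕ} → (∀ x → f x ≤ g x) → Σl xs f ≤ Σl xs g
    Σl-mono []       e = z≤n
    Σl-mono (x ∷ xs) e = +-mono-≤ (e x) (Σl-mono xs e)

    Σl-zero : ∀ xs (f : A → ℕ) → (∀ x → x ∈ xs → f x ≡ 0) → Σl xs f ≡ 0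
    Σl-zero []       f e = refl
    Σl-zero (x ∷ xs) f e = cong₂ _+_ (e x (here refl)) (Σl-zero xs f (λ y m → e y (there m)))

    Σl-zero⁻ : ∀ xs (f : A → ℕ) → Σl xs f ≡ 0 → ∀ x → x ∈ xs → f x ≡ 0
    Σl-zero⁻ (y ∷ xs) f e x (here refl) = m+n≡0⇒m≡0 (f y) e
    Σl-zero⁻ (y ∷ xs) f e x (there m)   = Σl-zero⁻ xs f (m+n≡0⇒n≡0 (f y) e) x m

    Σl-≥ : ∀ xs (f : A → ℕ) x → x ∈ xs → f x ≤ Σl xs f
    Σl-≥ (y ∷ xs) f x (here refl) = m≤m+n (f y) _
    Σl-≥ (y ∷ xs) f x (there m)   = ≤-trans (Σl-≥ xs f x m) (m≤n+m _ (f y))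

    Σl-point : ∀ xs (f : A → ℕ) c → Unique xs → c ∈ xs → (∀ a → a ≢ c → f a ≡ 0) → Σl xs f ≡ f c
    Σl-point (x ∷ xs) f c (x∉ ∷ u) (here refl) e =
      trans (cong (f x +_) (Σl-zero xs f (λ a m → e a (λ a≡x → All.lookup x∉ m (sym a≡x)))))
            (+-identityʳ _)
    Σl-point (x ∷ xs) f c (x∉ ∷ u) (there m) e =
      cong₂ _+_ (e x (λ x≡c → All.lookup x∉ m x≡c)) (Σl-point xs f c u m e)

    Σl-two : ∀ xs (f : A → ℕ) c d → Unique xs → c ∈ xs → d ∈ xs → c ≢ d → f c + f d ≤ Σl xs f
    Σl-two (x ∷ xs) f c d _ (here refl) (here refl) c≢d = ⊥-elim (c≢d refl)
    Σl-two (x ∷ xs) f c d _ (here refl) (there md)  _   = +-monoʳ-≤ (f x) (Σl-≥ xs f d md)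
    Σl-two (x ∷ xs) f c d _ (there mc)  (here refl) _   =
      ≤-trans (≤-reflexive (+-comm (f c) (f x))) (+-monoʳ-≤ (f x) (Σl-≥ xs f c mc))
    Σl-two (x ∷ xs) f c d (_ ∷ u) (there mc) (there md) c≢d =
      ≤-trans (Σl-two xs f c d u mc md c≢d) (m≤n+m _ (f x))

  Σl-map : ∀ {A B : Set} (g : A → B) xs (f : B → ℕ) → Σl (map g xs) f ≡ Σl xs (f ∘ g)
  Σl-map g xs f = cong sum (sym (map-∘ xs))

  Σl-swap : ∀ {A B : Set} (xs : List A) (ys : List B) (f : A → B → ℕ) →
            Σl xs (λ a → Σl ys (f a)) ≡ Σl ys (λ b → Σl xs (λ a → f a b))
  Σl-swap []       ys f = sym (Σl-zero ys _ (λ _ _ → refl))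
  Σl-swap (x ∷ xs) ys f rewrite Σl-swap xs ys f = sym (Σl-+ ys (f x) (λ b → Σl xs (λ a → f a b)))

  Σ< : ℕ → (ℕ → ℕ) → ℕ
  Σ< zero    f = 0
  Σ< (suc j) f = Σ< j f + f j

  Σ<-shift : ∀ j (f : ℕ → ℕ) → Σ< (suc j) f ≡ f 0 + Σ< j (λ i → f (suc i))
  Σ<-shift zero    f = +-comm 0 (f 0)
  Σ<-shift (suc j) f rewrite Σ<-shift j f = +-assoc (f 0) _ _

  Σ<-split : ∀ a j (f : ℕ → ℕ) → Σ< (a + j) f ≡ Σ< a f + Σ< j (λ i → f (a + i))
  Σ<-split a zero    f = trans (cong (λ z → Σ< z f) (+-identityʳ a)) (sym (+-identityʳ _))
  Σ<-split a (suc j) f = trans (cong (λ z → Σ< z f) (+-suc a j))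
    (trans (cong (_+ f (a + j)) (Σ<-split a j f)) (+-assoc (Σ< a f) _ _))

  Σ<-≥ : ∀ i j (f : ℕ → ℕ) → i < j → f i ≤ Σ< j f
  Σ<-≥ i (suc j) f l with m≤n⇒m<n∨m≡n (≤-pred l)
  ... | inj₁ l' = ≤-trans (Σ<-≥ i j f l') (m≤m+n _ _)
  ... | inj₂ refl = m≤n+m _ _

  telescope : ∀ n (r c b : ℕ → ℕ) → (∀ i → r (suc i) + c (suc i) ≡ b i + c i) →
              Σ< n (λ i → r (suc i)) + c n ≡ Σ< n b + c 0
  telescope zero    r c b step = refl
  telescope (suc n) r c b step = begin
    (Σ< n r' + r (suc n)) + c (suc n)   ≡⟨ +-assoc (Σ< n r') _ _ ⟩
    Σ< n r' + (r (suc n) + c (suc n))   ≡⟨ cong (Σ< n r' +_) (step n) ⟩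
    Σ< n r' + (b n + c n)               ≡⟨ swap-inner (Σ< n r') (b n) (c n) ⟩
    (Σ< n r' + c n) + b n               ≡⟨ cong (_+ b n) (telescope n r c b step) ⟩
    (Σ< n b + c 0) + b n                ≡⟨ right-comm (Σ< n b) (c 0) (b n) ⟩
    (Σ< n b + b n) + c 0                ∎
    where
      open ≡-Reasoning
      r' = λ i → r (suc i)

open Sums

module WordSums (k : ℕ) where

  Σf : (Fin k → ℕ) → ℕ
  Σf = Σl (allFin k)

  Σf-point : ∀ (f : Fin k → ℕ) c → (∀ a → a ≢ c → f a ≡ 0) → Σf f ≡ f c
  Σf-point f c = Σl-point (allFin k) f c (allFin⁺ k) (∈-allFin c)

  Σf-≥ : ∀ (f : Fin k → ℕ) c → f c ≤ Σf f
  Σf-≥ f c = Σl-≥ (allFin k) f c (∈-allFin c)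

  Σf-two : ∀ (f : Fin k → ℕ) c d → c ≢ d → f c + f d ≤ Σf f
  Σf-two f c d = Σl-two (allFin k) f c d (allFin⁺ k) (∈-allFin c) (∈-allFin d)

  Σf-zero : ∀ (f : Fin k → ℕ) → (∀ c → f c ≡ 0) → Σf f ≡ 0
  Σf-zero f e = Σl-zero (allFin k) f (λ c _ → e c)

  Σf-zero⁻ : ∀ (f : Fin k → ℕ) → Σf f ≡ 0 → ∀ c → f c ≡ 0
  Σf-zero⁻ f e c = Σl-zero⁻ (allFin k) f e c (∈-allFin c)

  ΣW : ℕ → (Word k → ℕ) → ℕ
  ΣW zero    g = g []
  ΣW (suc n) g = Σf (λ a → ΣW n (λ x → g (a ∷ x)))

  ΣW-ext : ∀ n {f g : Word k → ℕ} → (∀ x → length x ≡ n → f x ≡ g x) → ΣW n f ≡ ΣW n g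
  ΣW-ext zero    e = e [] refl
  ΣW-ext (suc n) e = Σl-ext (allFin k) (λ a → ΣW-ext n (λ x l → e (a ∷ x) (cong suc l)))

  ΣW-+ : ∀ n (f g : Word k → ℕ) → ΣW n (λ x → f x + g x) ≡ ΣW n f + ΣW n g
  ΣW-+ zero    f g = refl
  ΣW-+ (suc n) f g = trans (Σl-ext (allFin k) (λ a → ΣW-+ n _ _)) (Σl-+ (allFin k) _ _)

  ΣW-zero : ∀ n (f : Word k → ℕ) → (∀ x → length x ≡ n → f x ≡ 0) → ΣW n f ≡ 0
  ΣW-zero zero    f e = e [] refl
  ΣW-zero (suc n) f e = Σf-zero _ (λ a → ΣW-zero n _ (λ x l → e (a ∷ x) (cong suc l)))

  ΣW-zero⁻ : ∀ n (f : Word k → ℕ) → ΣW n f ≡ 0 → ∀ x → length x ≡ n → f x ≡ 0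
  ΣW-zero⁻ zero    f e []      l = e
  ΣW-zero⁻ (suc n) f e (a ∷ x) l = ΣW-zero⁻ n _ (Σf-zero⁻ _ e a) x (suc-injective l)

  ΣW-mono : ∀ n {f g : Word k → ℕ} → (∀ x → f x ≤ g x) → ΣW n f ≤ ΣW n g
  ΣW-mono zero    e = e []
  ΣW-mono (suc n) e = Σl-mono (allFin k) (λ a → ΣW-mono n (λ x → e (a ∷ x)))

  ΣW-≥ : ∀ n (f : Word k → ℕ) x → length x ≡ n → f x ≤ ΣW n f
  ΣW-≥ zero    f []      l = ≤-refl
  ΣW-≥ (suc n) f (a ∷ x) l = ≤-trans (ΣW-≥ n _ x (suc-injective l)) (Σf-≥ _ a)

  ΣW-point : ∀ (f : Word k → ℕ) w → (∀ x → length x ≡ length w → x ≢ w → f x ≡ 0) → ΣW (length w) f ≡ f w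
  ΣW-point f []      e = refl
  ΣW-point f (c ∷ w) e =
    trans (Σf-point _ c (λ a a≢c → ΣW-zero _ _ (λ x l → e (a ∷ x) (cong suc l) (λ eq → a≢c (proj₁ (∷-injective eq))))))
          (ΣW-point (λ x → f (c ∷ x)) w (λ x l x≢w → e (c ∷ x) (cong suc l) (λ eq → x≢w (∷-injectiveʳ eq))))

  ΣW-split : ∀ a b (g : Word k → ℕ) → ΣW (a + b) g ≡ ΣW a (λ x → ΣW b (λ y → g (x ++ y)))
  ΣW-split zero    b g = refl
  ΣW-split (suc a) b g = Σl-ext (allFin k) (λ c → ΣW-split a b (λ x → g (c ∷ x)))

  ΣW-snoc : ∀ n (g : Word k → ℕ) → ΣW (suc n) g ≡ ΣW n (λ x → Σf (λ b → g (x ++ [ b ])))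
  ΣW-snoc n g = trans (cong (λ j → ΣW j g) (+-comm 1 n)) (ΣW-split n 1 g)

  ΣW-swap : ∀ n (g : Fin k → Word k → ℕ) → ΣW n (λ x → Σf (λ a → g a x)) ≡ Σf (λ a → ΣW n (g a))
  ΣW-swap zero    g = refl
  ΣW-swap (suc n) g = trans (Σl-ext (allFin k) (λ c → ΣW-swap n (λ a x → g a (c ∷ x))))
                            (Σl-swap (allFin k) (allFin k) (λ c a → ΣW n (λ x → g a (c ∷ x))))

module Classical (LEM : (P : Set) → Dec P) where

  ind : Set → ℕ
  ind P with LEM P
  ... | yes _ = 1
  ... | no  _ = 0

  ind-yes : ∀ {P} → P → ind P ≡ 1
  ind-yes {P} p with LEM P
  ... | yes _ = refl
  ... | no ¬p = ⊥-elim (¬p p)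

  ind-no : ∀ {P} → ¬ P → ind P ≡ 0
  ind-no {P} ¬p with LEM P
  ... | yes p = ⊥-elim (¬p p)
  ... | no  _ = refl

  ind≤1 : ∀ P → ind P ≤ 1
  ind≤1 P with LEM P
  ... | yes _ = s≤s z≤n
  ... | no  _ = z≤n

  ind-iff : ∀ {P Q} → (P → Q) → (Q → P) → ind P ≡ ind Q
  ind-iff {P} {Q} f g with LEM Q
  ... | yes q = ind-yes (g q)
  ... | no ¬q = ind-no (λ p → ¬q (f p))

  ind-× : ∀ P Q → ind (P × Q) ≡ ind P * ind Q
  ind-× P Q with LEM P | LEM Q
  ... | yes p | yes q = ind-yes (p , q)
  ... | yes p | no ¬q = ind-no (λ pq → ¬q (proj₂ pq))
  ... | no ¬p | _     = ind-no (λ pq → ¬p (proj₁ pq))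

  ind-⊎ : ∀ P Q → (P → Q → ⊥) → ind (P ⊎ Q) ≡ ind P + ind Q
  ind-⊎ P Q disj with LEM P | LEM Q
  ... | yes p | yes q = ⊥-elim (disj p q)
  ... | yes p | no  _ = ind-yes (inj₁ p)
  ... | no  _ | yes q = ind-yes (inj₂ q)
  ... | no ¬p | no ¬q = ind-no λ { (inj₁ p) → ¬p p ; (inj₂ q) → ¬q q }

  module Letters (k : ℕ) where
    open WordSums k

    Σf-unique : ∀ (P : Fin k → Set) → Σf (λ a → ind (P a)) ≤ 1 → ∀ c d → P c → P d → c ≡ d
    Σf-unique P h c d pc pd with LEM (c ≡ d)
    ... | yes c≡d = c≡d
    ... | no  c≢d = ⊥-elim (<-irrefl refl (begin-strict
          1                                 <⟨ s≤s ≤-refl ⟩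
          1 + 1                             ≡⟨ cong₂ _+_ (sym (ind-yes pc)) (sym (ind-yes pd)) ⟩
          ind (P c) + ind (P d)             ≤⟨ Σf-two (λ a → ind (P a)) c d c≢d ⟩
          Σf (λ a → ind (P a))              ≤⟨ h ⟩
          1                                 ∎))
      where open ≤-Reasoning

    Σf-one : ∀ (P : Fin k → Set) c → P c → (∀ d → P d → d ≡ c) → Σf (λ a → ind (P a)) ≡ 1
    Σf-one P c pc uniq = trans (Σf-point _ c (λ a a≢c → ind-no (λ pa → a≢c (uniq a pa)))) (ind-yes pc)

  search-below : (P : ℕ → Set) → ∀ b → (∀ j → j < b → ¬ P j) ⊎ Σ ℕ (λ l → P l × (∀ j → j < l → ¬ P j))
  search-below P zero = inj₁ (λ j ())
  search-below P (suc b) with search-below P b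
  ... | inj₂ found = inj₂ found
  ... | inj₁ none with LEM (P b)
  ...   | yes pb = inj₂ (b , pb , none)
  ...   | no ¬pb = inj₁ λ j j<1+b → below-or-at (m≤n⇒m<n∨m≡n (≤-pred j<1+b))
    where
      below-or-at : ∀ {j} → (j < b) ⊎ (j ≡ b) → ¬ P j
      below-or-at (inj₁ j<b)  = none _ j<b
      below-or-at (inj₂ refl) = ¬pb

  least : (P : ℕ → Set) → ∀ n → P n → Σ ℕ λ l → P l × (∀ j → j < l → ¬ P j)
  least P n p with search-below P (suc n)
  ... | inj₂ found = found
  ... | inj₁ none  = ⊥-elim (none n ≤-refl p)

  eventually-zero : ∀ s (f : ℕ → ℕ) → (∀ j → Σ< j f ≤ s) → Σ ℕ λ J → ∀ i → J ≤ i → f i ≡ 0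
  eventually-zero s f bounded with LEM (Σ ℕ λ i → 0 < f i)
  ... | no none = 0 , λ i _ → n≤0⇒n≡0 (≮⇒≥ (λ p → none (i , p)))
  eventually-zero zero f bounded | yes (i₀ , pos) =
    ⊥-elim (<-irrefl refl (≤-trans pos (≤-trans (Σ<-≥ i₀ (suc i₀) f ≤-refl) (bounded (suc i₀)))))
  eventually-zero (suc s) f bounded | yes (i₀ , pos)
    with eventually-zero s (λ i → f (suc i₀ + i)) tail-bounded
    where
      -- past i₀ the partial sums lose at least the positive term f i₀
      tail-bounded : ∀ j → Σ< j (λ i → f (suc i₀ + i)) ≤ s
      tail-bounded j = ≤-pred (begin
        suc (Σ< j (λ i → f (suc i₀ + i)))               ≡⟨ +-comm 1 _ ⟩
        Σ< j (λ i → f (suc i₀ + i)) + 1                 ≤⟨ +-monoʳ-≤ _ (≤-trans pos (Σ<-≥ i₀ (suc i₀) f ≤-refl)) ⟩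
        Σ< j (λ i → f (suc i₀ + i)) + Σ< (suc i₀) f     ≡⟨ +-comm _ (Σ< (suc i₀) f) ⟩
        Σ< (suc i₀) f + Σ< j (λ i → f (suc i₀ + i))     ≡⟨ sym (Σ<-split (suc i₀) j f) ⟩
        Σ< (suc i₀ + j) f                               ≤⟨ bounded (suc i₀ + j) ⟩
        suc s                                           ∎)
        where open ≤-Reasoning
  ... | J' , zeroes = suc i₀ + J' , λ i l →
        trans (cong f (sym (m+[n∸m]≡n (≤-trans (m≤m+n (suc i₀) J') l))))
              (zeroes (i ∸ suc i₀) (≤-trans (≤-reflexive (sym (m+n∸m≡n (suc i₀) J'))) (∸-monoˡ-≤ (suc i₀) l)))

module ListFacts {A : Set} where

  take-++-length : ∀ (p q : List A) → take (length p) (p ++ q) ≡ p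
  take-++-length []      q = refl
  take-++-length (x ∷ p) q = cong (x ∷_) (take-++-length p q)

  drop-++-length : ∀ (p q : List A) → drop (length p) (p ++ q) ≡ q
  drop-++-length []      q = refl
  drop-++-length (x ∷ p) q = drop-++-length p q

  take-++ˡ : ∀ n (x y : List A) → n ≤ length x → take n (x ++ y) ≡ take n x
  take-++ˡ zero    x       y l       = refl
  take-++ˡ (suc n) (a ∷ x) y (s≤s l) = cong (a ∷_) (take-++ˡ n x y l)

  drop-++ˡ : ∀ n (x y : List A) → n ≤ length x → drop n (x ++ y) ≡ drop n x ++ y
  drop-++ˡ zero    x       y l       = refl
  drop-++ˡ (suc n) (a ∷ x) y (s≤s l) = drop-++ˡ n x y l

  length-take≤ : ∀ n (x : List A) → n ≤ length x → length (take n x) ≡ n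
  length-take≤ zero    x       l       = refl
  length-take≤ (suc n) (a ∷ x) (s≤s l) = cong suc (length-take≤ n x l)

  length-snoc : ∀ (u : List A) b → length (u ++ [ b ]) ≡ suc (length u)
  length-snoc u b = trans (length-++ u) (+-comm (length u) 1)

  ++-split : ∀ (p u : List A) {q v} → length p ≡ length u → p ++ q ≡ u ++ v → p ≡ u × q ≡ v
  ++-split []      []      _ eq = refl , eq
  ++-split (x ∷ p) (y ∷ u) l eq with ∷-injective eq
  ... | refl , eq' with ++-split p u (suc-injective l) eq'
  ... | refl , q≡v = refl , q≡v

  suffix : ∀ (a b c e : List A) → a ++ b ≡ c ++ e → length e ≤ length b → Σ (List A) λ z → b ≡ z ++ e
  suffix []      b c       e eq l = c , eq
  suffix (x ∷ a) b []      e eq l = ⊥-elim (<-irrefl refl (begin-strict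
    length b              <⟨ s≤s (length-++-≤ʳ b {a}) ⟩
    length (x ∷ a ++ b)   ≡⟨ cong length eq ⟩
    length e              ≤⟨ l ⟩
    length b              ∎))
    where open ≤-Reasoning
  suffix (x ∷ a) b (y ∷ c) e eq l = suffix a b c e (∷-injectiveʳ eq) l

open ListFacts

module Factors {k : ℕ} (S : ShiftSpace k) where

  length-window : ∀ (x : Seq k) i n → length (window x i n) ≡ n
  length-window x i zero    = refl
  length-window x i (suc n) = cong suc (length-window x _ n)

  window-+ : ∀ (x : Seq k) i a b → window x i (a + b) ≡ window x i a ++ window x (i ℤ.+ ℤ.+ a) b
  window-+ x i zero    b = cong (λ j → window x j b) (sym (ℤP.+-identityʳ i))
  window-+ x i (suc a) b = cong (x i ∷_) (trans (window-+ x (i ℤ.+ ℤ.+ 1) a b)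
    (cong (λ j → window x (i ℤ.+ ℤ.+ 1) a ++ window x j b) (ℤP.+-assoc i (ℤ.+ 1) (ℤ.+ a))))

  window-split : ∀ (x : Seq k) i u v → window x i (length (u ++ v)) ≡ u ++ v →
                 window x i (length u) ≡ u × window x (i ℤ.+ ℤ.+ length u) (length v) ≡ v
  window-split x i u v e = ++-split _ u (length-window x i _)
    (trans (sym (window-+ x i (length u) (length v))) (trans (cong (window x i) (sym (length-++ u))) e))

  Lang-++ˡ : ∀ u v → Lang S (u ++ v) → Lang S u
  Lang-++ˡ u v (x , Xx , i , e) = x , Xx , i , proj₁ (window-split x i u v e)

  Lang-++ʳ : ∀ u v → Lang S (u ++ v) → Lang S v
  Lang-++ʳ u v (x , Xx , i , e) = x , Xx , i ℤ.+ ℤ.+ length u , proj₂ (window-split x i u v e)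

  Lang-tail : ∀ a u → Lang S (a ∷ u) → Lang S u
  Lang-tail a = Lang-++ʳ [ a ]

  Lang-snoc : ∀ u → Lang S u → ∃[ b ] Lang S (u ++ [ b ])
  Lang-snoc u (x , Xx , i , e) = x (i ℤ.+ ℤ.+ length u) , x , Xx , i ,
    trans (cong (window x i) (length-snoc u _))
      (trans (trans (cong (window x i) (+-comm 1 (length u))) (window-+ x i (length u) 1))
             (cong (_++ [ x (i ℤ.+ ℤ.+ length u) ]) e))

  Lang-cons : ∀ u → Lang S u → ∃[ a ] Lang S (a ∷ u)
  Lang-cons u (x , Xx , i , e) = x (i ℤ.+ ℤ.-[1+ 0 ]) , x , Xx , i ℤ.+ ℤ.-[1+ 0 ] ,
    cong (x (i ℤ.+ ℤ.-[1+ 0 ]) ∷_) (trans (cong (λ j → window x j (length u)) back) e)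
    where
      back : i ℤ.+ ℤ.-[1+ 0 ] ℤ.+ ℤ.+ 1 ≡ i
      back = trans (ℤP.+-assoc i ℤ.-[1+ 0 ] (ℤ.+ 1)) (ℤP.+-identityʳ i)

  Lang-extend : ∀ u n → Lang S u → ∃[ t ] (Lang S (u ++ t) × length t ≡ n)
  Lang-extend u zero    h = [] , subst (Lang S) (sym (++-identityʳ u)) h , refl
  Lang-extend u (suc n) h with Lang-snoc u h
  ... | b , hb with Lang-extend (u ++ [ b ]) n hb
  ... | t , ht , lt = b ∷ t , subst (Lang S) (++-assoc u [ b ] t) ht , cong suc lt

-- Root the tree at a left vertex r and let d x be the distance from x to r.
-- Adjacent vertices have depths differing by exactly one (the graph is
-- bipartite), so every edge has a unique orientation u → v with d v = d u + 1,
-- i.e. u is a parent of v.  Every vertex except r has a parent, and at most one: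
-- two parents would close a cycle through their common ancestor.
module TreeCount (LEM : (P : Set) → Dec P) {k : ℕ} (S : ShiftSpace k) (w : Word k)
                 (tree : IsTree S w) (Lw : Lang S w) where
  open Classical LEM
  open Letters k
  open WordSums k
  open Factors S

  V : Set
  V = Fin k ⊎ Fin k

  Vt : V → Set
  Vt = Vert S w

  Ad : V → V → Set
  Ad = Adj S w

  adj-vertices : ∀ x y → Ad x y → Vt x × Vt y
  adj-vertices (inj₁ a) (inj₂ b) h = Lang-++ˡ (a ∷ w) [ b ] h , Lang-tail a (w ++ [ b ]) h
  adj-vertices (inj₂ b) (inj₁ a) h = Lang-tail a (w ++ [ b ]) h , Lang-++ˡ (a ∷ w) [ b ] h

  adj-sym : ∀ x y → Ad x y → Ad y x
  adj-sym (inj₁ a) (inj₂ b) h = h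
  adj-sym (inj₂ b) (inj₁ a) h = h

  side : V → Bool
  side (inj₁ _) = true
  side (inj₂ _) = false

  adj-side : ∀ x y → Ad x y → side y ≡ not (side x)
  adj-side (inj₁ a) (inj₂ b) h = refl
  adj-side (inj₂ b) (inj₁ a) h = refl

  root : V
  root = inj₁ (proj₁ (Lang-cons w Lw))

  root-vertex : Vt root
  root-vertex = proj₂ (Lang-cons w Lw)

  Reach : ℕ → V → Set
  Reach zero    x = x ≡ root
  Reach (suc n) x = Σ V λ u → Ad x u × Reach n u

  flips : ℕ → Bool → Bool
  flips zero    b = b
  flips (suc n) b = not (flips n b)

  reach-side : ∀ n x → Reach n x → side x ≡ flips n (side root)
  reach-side zero    x refl          = refl
  reach-side (suc n) x (u , a , p) =
    trans (sym (not-involutive (side x))) (cong not (trans (sym (adj-side x u a)) (reach-side n u p)))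

  walk-reach : ∀ x vs → Linked Ad (x ∷ vs ++ [ root ]) → Reach (suc (length vs)) x
  walk-reach x []       (a ∷ [-]) = root , a , refl
  walk-reach x (y ∷ vs) (a ∷ l)   = y , a , walk-reach y vs l

  reach : ∀ x → Vt x → Σ ℕ λ n → Reach n x
  reach x vx with proj₁ tree x root vx root-vertex
  ... | inj₁ refl       = 0 , refl
  ... | inj₂ (vs , l)   = _ , walk-reach x vs l

  depth-of : (x : V) → Dec (Σ ℕ λ n → Reach n x) → ℕ
  depth-of x (yes (n , p)) = proj₁ (least (λ j → Reach j x) n p)
  depth-of x (no _)        = 0

  d : V → ℕ
  d x = depth-of x (LEM _)

  depth-spec : ∀ x n → Reach n x → Reach (d x) x × d x ≤ n
  depth-spec x n p = go (LEM (Σ ℕ λ n → Reach n x))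
    where
      go : (dec : Dec (Σ ℕ λ n → Reach n x)) → Reach (depth-of x dec) x × depth-of x dec ≤ n
      go (yes (n' , p')) with least (λ j → Reach j x) n' p'
      ... | l , pl , minimal = pl , ≮⇒≥ (λ n<l → minimal n n<l p)
      go (no ¬r) = ⊥-elim (¬r (n , p))

  reach-depth : ∀ x → Vt x → Reach (d x) x
  reach-depth x vx = proj₁ (depth-spec x _ (proj₂ (reach x vx)))

  depth≤ : ∀ x n → Reach n x → d x ≤ n
  depth≤ x n p = proj₂ (depth-spec x n p)

  depth-root : d root ≡ 0
  depth-root = n≤0⇒n≡0 (depth≤ root 0 refl)

  depth-zero : ∀ x → Vt x → d x ≡ 0 → x ≡ root
  depth-zero x vx e = subst (λ j → Reach j x) e (reach-depth x vx)

  depth-root⁻ : ∀ x n → d x ≡ suc n → x ≢ root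
  depth-root⁻ x n e refl = 0≢1+n (trans (sym depth-root) e)

  depth-step : ∀ x y → Ad x y → d x ≤ suc (d y)
  depth-step x y a = depth≤ x (suc (d y)) (y , a , reach-depth y (proj₂ (adj-vertices x y a)))

  depth-adj : ∀ x y → Ad x y → (suc (d x) ≡ d y) ⊎ (suc (d y) ≡ d x)
  depth-adj x y a with <-cmp (d x) (d y)
  ... | tri< x<y _ _ = inj₁ (≤-antisym x<y (depth-step y x (adj-sym x y a)))
  ... | tri> _ _ y<x = inj₂ (≤-antisym y<x (depth-step x y a))
  ... | tri≈ _ e _   = ⊥-elim (not-¬ same-side (adj-side x y a))
    where
      same-side : side y ≡ side x
      same-side = begin
        side y                    ≡⟨ reach-side _ y (reach-depth y (proj₂ (adj-vertices x y a))) ⟩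
        flips (d y) (side root)   ≡⟨ cong (λ j → flips j (side root)) (sym e) ⟩
        flips (d x) (side root)   ≡⟨ sym (reach-side _ x (reach-depth x (proj₁ (adj-vertices x y a)))) ⟩
        side x                    ∎
        where open ≡-Reasoning

  Parent : V → V → Set
  Parent u v = Ad u v × suc (d u) ≡ d v

  -- the next vertex of a shortest walk to the root is a parent
  parent-exists : ∀ v → Vt v → v ≢ root → Σ V λ u → Parent u v
  parent-exists v vv v≢root with d v in eq
  ... | zero  = ⊥-elim (v≢root (depth-zero v vv eq))
  ... | suc n with subst (λ j → Reach j v) eq (reach-depth v vv)
  ... | u , a , p = u , adj-sym v u a ,
        cong suc (≤-antisym (depth≤ u n p) (≤-pred (≤-trans (≤-reflexive (sym eq)) (depth-step v u a))))

  path : V → List V → V → List V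
  path x mid x' = x ∷ mid ++ [ x' ]

  ∈-path⁻ : ∀ {u x x'} mid → u ∈ path x mid x' → u ≡ x ⊎ u ∈ mid ⊎ u ≡ x'
  ∈-path⁻ mid (here refl) = inj₁ refl
  ∈-path⁻ mid (there m) with ∈-++⁻ mid m
  ... | inj₁ m'          = inj₂ (inj₁ m')
  ... | inj₂ (here refl) = inj₂ (inj₂ refl)

  linked-snoc : ∀ {Q : V → V → Set} xs {y z} → Linked Q (xs ++ [ y ]) → Q y z → Linked Q ((xs ++ [ y ]) ++ [ z ])
  linked-snoc []            l         q = q ∷ [-]
  linked-snoc (x ∷ [])      (h ∷ [-]) q = h ∷ q ∷ [-]
  linked-snoc (x ∷ x' ∷ xs) (h ∷ l)   q = h ∷ linked-snoc (x' ∷ xs) l q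

  path-unique : ∀ {x x'} mid → Unique mid → x ≢ x' →
                (∀ u → u ∈ mid → x ≢ u × u ≢ x') → Unique (path x mid x')
  path-unique {x} {x'} mid U x≢x' fresh =
    All.tabulate x-fresh ∷ ++⁺ U (All.[] ∷ []) λ { (m , here refl) → proj₂ (fresh _ m) refl }
    where
      x-fresh : ∀ {u} → u ∈ mid ++ [ x' ] → x ≢ u
      x-fresh m with ∈-++⁻ mid m
      ... | inj₁ m'          = proj₁ (fresh _ m')
      ... | inj₂ (here refl) = x≢x'

  deeper-≢ : ∀ {x u n} → d x ≡ suc n → d u ≤ n → x ≢ u
  deeper-≢ e l refl = 1+n≰n (≤-trans (≤-reflexive (sym e)) l)

  ShallowPath : ℕ → V → V → Set
  ShallowPath n x x' = Σ (List V) λ mid →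
    Linked Ad (path x mid x') × Unique (path x mid x') × (∀ u → u ∈ path x mid x' → d u ≤ n)

  close-path : ∀ {n x x'} inner → d x ≡ suc n → d x' ≡ suc n → x ≢ x' → Linked Ad (path x inner x') →
               Unique inner → (∀ u → u ∈ inner → d u ≤ n) → ShallowPath (suc n) x x'
  close-path {n} {x} {x'} inner e e' x≢x' L U B =
    inner , L , path-unique inner U x≢x' (λ u m → deeper-≢ e (B u m) , λ u≡x' → deeper-≢ e' (B u m) (sym u≡x')) , bound
    where
      bound : ∀ u → u ∈ path x inner x' → d u ≤ suc n
      bound u m with ∈-path⁻ inner m
      ... | inj₁ refl        = ≤-reflexive e
      ... | inj₂ (inj₁ m')   = m≤n⇒m≤1+n (B u m')
      ... | inj₂ (inj₂ refl) = ≤-reflexive e'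

  -- distinct vertices of equal depth n are joined through their common ancestor
  join : ∀ n x x' → d x ≡ n → d x' ≡ n → Vt x → Vt x' → x ≢ x' → ShallowPath n x x'
  join zero x x' e e' vx vx' x≢x' = ⊥-elim (x≢x' (trans (depth-zero x vx e) (sym (depth-zero x' vx' e'))))
  join (suc n) x x' e e' vx vx' x≢x'
    with parent-exists x vx (depth-root⁻ x n e) | parent-exists x' vx' (depth-root⁻ x' n e')
  ... | p , (a , ep) | p' , (a' , ep') with LEM (p ≡ p')
  ... | yes refl = close-path [ p ] e e' x≢x' (adj-sym p x a ∷ a' ∷ [-]) (All.[] ∷ [])
                     (λ { u (here refl) → ≤-reflexive dp })
    where dp = suc-injective (trans ep e)
  ... | no p≢p' with join n p p' (suc-injective (trans ep e)) (suc-injective (trans ep' e'))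
                        (proj₁ (adj-vertices p x a)) (proj₁ (adj-vertices p' x' a')) p≢p'
  ... | mid , L , U , B = close-path (path p mid p') e e' x≢x' (adj-sym p x a ∷ linked-snoc (p ∷ mid) L a') U B

  -- a vertex has at most one parent: two parents and the path joining them form a cycle
  parent-unique : ∀ y x x' → Parent x y → Parent x' y → x ≡ x'
  parent-unique y x x' (a , e) (a' , e') with LEM (x ≡ x')
  ... | yes x≡x' = x≡x'
  ... | no  x≢x' with join (d x) x x' refl (suc-injective (trans e' (sym e)))
                          (proj₁ (adj-vertices x y a)) (proj₁ (adj-vertices x' y a')) x≢x'
  ... | mid , L , U , B = ⊥-elim (proj₂ tree (y , path x mid x' , long , unique , cycle))
    where
      long : 3 ≤ length (y ∷ path x mid x')
      long = s≤s (s≤s (≤-trans (s≤s z≤n) (≤-reflexive (sym (length-snoc mid x')))))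
      unique : Unique (y ∷ path x mid x')
      unique = All.tabulate (λ {u} m → deeper-≢ (sym e) (B u m)) ∷ U
      cycle : Linked Ad (y ∷ path x mid x' ++ [ y ])
      cycle = adj-sym x y a ∷ linked-snoc (x ∷ mid) L a'

  ΣV : (V → ℕ) → ℕ
  ΣV f = Σf (λ a → f (inj₁ a)) + Σf (λ b → f (inj₂ b))

  ΣV-ext : ∀ {f g : V → ℕ} → (∀ v → f v ≡ g v) → ΣV f ≡ ΣV g
  ΣV-ext e = cong₂ _+_ (Σl-ext (allFin k) (λ a → e (inj₁ a))) (Σl-ext (allFin k) (λ b → e (inj₂ b)))

  ΣV-+ : ∀ (f g : V → ℕ) → ΣV (λ v → f v + g v) ≡ ΣV f + ΣV g
  ΣV-+ f g = trans (cong₂ _+_ (Σl-+ (allFin k) (f ∘ inj₁) (g ∘ inj₁)) (Σl-+ (allFin k) (f ∘ inj₂) (g ∘ inj₂)))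
                   (interchange (Σf (f ∘ inj₁)) (Σf (g ∘ inj₁)) (Σf (f ∘ inj₂)) (Σf (g ∘ inj₂)))

  ΣV-one : ∀ (P : V → Set) c → P c → (∀ u → P u → u ≡ c) → ΣV (λ u → ind (P u)) ≡ 1
  ΣV-one P (inj₁ a) pc uniq =
    cong₂ _+_ (Σf-one (P ∘ inj₁) a pc (λ x px → inj₁-injective (uniq _ px)))
              (Σf-zero _ (λ b → ind-no (λ pb → inj₂≢inj₁ (uniq _ pb))))
    where inj₂≢inj₁ : ∀ {b} → inj₂ b ≢ inj₁ a
          inj₂≢inj₁ ()
  ΣV-one P (inj₂ b) pc uniq =
    cong₂ _+_ (Σf-zero _ (λ a → ind-no (λ pa → inj₁≢inj₂ (uniq _ pa))))
              (Σf-one (P ∘ inj₂) b pc (λ x px → inj₂-injective (uniq _ px)))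
    where inj₁≢inj₂ : ∀ {a} → inj₁ a ≢ inj₂ b
          inj₁≢inj₂ ()

  parents : V → ℕ
  parents v = ΣV (λ u → ind (Parent u v))

  parents-count : ∀ v → parents v ≡ ind (Vt v × v ≢ root)
  parents-count v with LEM (Vt v × v ≢ root)
  ... | yes (vv , v≢root) with parent-exists v vv v≢root
  ...   | u , pu = ΣV-one (λ u → Parent u v) u pu (λ u' pu' → parent-unique v u' u pu' pu)
  parents-count v | no ¬nonroot =
    cong₂ _+_ (Σf-zero _ (λ a → ind-no (no-parent (inj₁ a)))) (Σf-zero _ (λ b → ind-no (no-parent (inj₂ b))))
    where
      no-parent : ∀ u → ¬ Parent u v
      no-parent u (a , e) = ¬nonroot (proj₂ (adj-vertices u v a) , depth-root⁻ v (d u) (sym e))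

  parents-right : ∀ b → parents (inj₂ b) ≡ Σf (λ a → ind (Parent (inj₁ a) (inj₂ b)))
  parents-right b = trans (cong (Σf (λ a → ind (Parent (inj₁ a) (inj₂ b))) +_) (Σf-zero _ (λ _ → ind-no λ { (() , _) })))
                          (+-identityʳ _)

  parents-left : ∀ a → parents (inj₁ a) ≡ Σf (λ b → ind (Parent (inj₂ b) (inj₁ a)))
  parents-left a = cong (_+ Σf (λ b → ind (Parent (inj₂ b) (inj₁ a)))) (Σf-zero _ (λ _ → ind-no λ { (() , _) }))

  edge-orient : ∀ a b → ind (Lang S (a ∷ w ++ [ b ])) ≡ ind (Parent (inj₁ a) (inj₂ b)) + ind (Parent (inj₂ b) (inj₁ a))
  edge-orient a b = trans (ind-iff orient forget)
                          (ind-⊎ _ _ (λ { (_ , e₁) (_ , e₂) → <-asym (≤-reflexive e₁) (≤-reflexive e₂) }))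
    where
      orient : Lang S (a ∷ w ++ [ b ]) → Parent (inj₁ a) (inj₂ b) ⊎ Parent (inj₂ b) (inj₁ a)
      orient h with depth-adj (inj₁ a) (inj₂ b) h
      ... | inj₁ e = inj₁ (h , e)
      ... | inj₂ e = inj₂ (h , e)
      forget : Parent (inj₁ a) (inj₂ b) ⊎ Parent (inj₂ b) (inj₁ a) → Lang S (a ∷ w ++ [ b ])
      forget (inj₁ (h , _)) = h
      forget (inj₂ (h , _)) = h

  -- counting the edges by their lower endpoint
  edges-parents : Σf (λ a → Σf (λ b → ind (Lang S (a ∷ w ++ [ b ])))) ≡ ΣV parents
  edges-parents = begin
    Σf (λ a → Σf (λ b → ind (Lang S (a ∷ w ++ [ b ]))))
      ≡⟨ Σl-ext (allFin k) (λ a → trans (Σl-ext (allFin k) (edge-orient a)) (Σl-+ (allFin k) _ _)) ⟩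
    Σf (λ a → Σf (λ b → ind (Parent (inj₁ a) (inj₂ b))) + Σf (λ b → ind (Parent (inj₂ b) (inj₁ a))))
      ≡⟨ Σl-+ (allFin k) _ _ ⟩
    Σf (λ a → Σf (λ b → ind (Parent (inj₁ a) (inj₂ b)))) + Σf (λ a → Σf (λ b → ind (Parent (inj₂ b) (inj₁ a))))
      ≡⟨ cong₂ _+_ (Σl-swap (allFin k) (allFin k) _) (sym (Σl-ext (allFin k) parents-left)) ⟩
    Σf (λ b → Σf (λ a → ind (Parent (inj₁ a) (inj₂ b)))) + Σf (λ a → parents (inj₁ a))
      ≡⟨ cong (_+ Σf (λ a → parents (inj₁ a))) (sym (Σl-ext (allFin k) parents-right)) ⟩
    Σf (λ b → parents (inj₂ b)) + Σf (λ a → parents (inj₁ a))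
      ≡⟨ +-comm (Σf (λ b → parents (inj₂ b))) (Σf (λ a → parents (inj₁ a))) ⟩
    ΣV parents ∎
    where open ≡-Reasoning

  -- counting the vertices: each non-root vertex has one parent
  vertices-parents : ΣV (λ v → ind (Vt v)) ≡ ΣV parents + 1
  vertices-parents = begin
    ΣV (λ v → ind (Vt v))
      ≡⟨ ΣV-ext split ⟩
    ΣV (λ v → ind (Vt v × v ≢ root) + ind (v ≡ root))
      ≡⟨ ΣV-+ (λ v → ind (Vt v × v ≢ root)) (λ v → ind (v ≡ root)) ⟩
    ΣV (λ v → ind (Vt v × v ≢ root)) + ΣV (λ v → ind (v ≡ root))
      ≡⟨ cong₂ _+_ (sym (ΣV-ext parents-count)) (ΣV-one (_≡ root) root refl (λ _ e → e)) ⟩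
    ΣV parents + 1 ∎
    where
      open ≡-Reasoning
      split : ∀ v → ind (Vt v) ≡ ind (Vt v × v ≢ root) + ind (v ≡ root)
      split v = trans (ind-iff {Q = (Vt v × v ≢ root) ⊎ (v ≡ root)} to from) (ind-⊎ _ _ (λ { (_ , v≢r) v≡r → v≢r v≡r }))
        where
          to : Vt v → (Vt v × v ≢ root) ⊎ (v ≡ root)
          to vv with LEM (v ≡ root)
          ... | yes v≡r = inj₂ v≡r
          ... | no  v≢r = inj₁ (vv , v≢r)
          from : (Vt v × v ≢ root) ⊎ (v ≡ root) → Vt v
          from (inj₁ (vv , _)) = vv
          from (inj₂ refl)     = root-vertex

  tree-count : Σf (λ a → Σf (λ b → ind (Lang S (a ∷ w ++ [ b ])))) + 1
             ≡ Σf (λ a → ind (Lang S (a ∷ w))) + Σf (λ b → ind (Lang S (w ++ [ b ])))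
  tree-count = trans (cong (_+ 1) edges-parents) (sym vertices-parents)

module Occurrences {k : ℕ} (S : ShiftSpace k) (v : Word k) where

  OA : Word k → ℕ → Set
  OA = OccursAt S v

  Occurs : Word k → Set
  Occurs z = Σ ℕ (OA z)

  occurs-prefix : ∀ u → OA (v ++ u) 0
  occurs-prefix u = length-++-≤ˡ v , take-++-length v u

  occurs-middle : ∀ p r → OA (p ++ v ++ r) (length p)
  occurs-middle p r = bound , trans (cong (take (length v)) (drop-++-length p (v ++ r))) (take-++-length v r)
    where
      bound : length p + length v ≤ length (p ++ v ++ r)
      bound = ≤-trans (+-monoʳ-≤ (length p) (length-++-≤ˡ v)) (≤-reflexive (sym (length-++ p)))

  occurs-length : ∀ z i → OA z i → length v ≤ length z
  occurs-length z i (l , _) = ≤-trans (m≤n+m _ i) l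

  private
    fits : ∀ (z : Word k) i → i + length v ≤ length z → length v ≤ length (drop i z)
    fits z i l = ≤-trans (≤-reflexive (sym (m+n∸m≡n i (length v))))
                         (≤-trans (∸-monoˡ-≤ i l) (≤-reflexive (sym (length-drop i z))))

  occurs-++ʳ : ∀ z y i → OA z i → OA (z ++ y) i
  occurs-++ʳ z y i (l , e) = ≤-trans l (length-++-≤ˡ z) ,
    trans (cong (take (length v)) (drop-++ˡ i z y (≤-trans (m≤m+n i _) l)))
          (trans (take-++ˡ (length v) (drop i z) y (fits z i l)) e)

  occurs-++ʳ⁻ : ∀ z y i → OA (z ++ y) i → i + length v ≤ length z → OA z i
  occurs-++ʳ⁻ z y i (l , e) l' = l' ,
    trans (sym (take-++ˡ (length v) (drop i z) y (fits z i l')))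
          (trans (cong (take (length v)) (sym (drop-++ˡ i z y (≤-trans (m≤m+n i _) l')))) e)

  occurs-∷ : ∀ a z i → OA (a ∷ z) (suc i) → OA z i
  occurs-∷ a z i (s≤s l , e) = l , e

  occurs-∷⁻ : ∀ a z i → OA z i → OA (a ∷ z) (suc i)
  occurs-∷⁻ a z i (l , e) = s≤s l , e

  occurs-decompose : ∀ z i → OA z i → z ≡ take i z ++ v ++ drop (i + length v) z
  occurs-decompose z i (l , e) =
    trans (sym (take++drop≡id i z)) (cong (take i z ++_)
      (trans (sym (take++drop≡id (length v) (drop i z))) (cong₂ _++_ e (drop-drop i (length v) z))))

  occurs-shorten : ∀ t z i → OccursAt S (v ++ t) z i → OA z i
  occurs-shorten t z i (l , e) =
    ≤-trans (+-monoʳ-≤ i (length-++-≤ˡ v)) l ,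
    trans (cong (take (length v)) (sym (take++drop≡id (length (v ++ t)) (drop i z))))
      (trans (cong (λ q → take (length v) (q ++ drop (length (v ++ t)) (drop i z))) e)
        (trans (cong (take (length v)) (++-assoc v t _)) (take-++-length v _)))

-- A word u is pending when
-- wu ∈ L(X) and w occurs in wu only as a prefix; return words are exactly the
-- one-letter extensions ub of pending words u for which wub ends with w.
module ReturnWords (LEM : (P : Set) → Dec P) {k : ℕ} (S : ShiftSpace k) (c : Fin k) (w' : Word k) where
  open Classical LEM
  open Factors S

  w : Word k
  w = c ∷ w'

  open Occurrences S w public

  Pending : Word k → Set
  Pending u = Lang S (w ++ u) × ¬ Occurs (w' ++ u)

  overrun : ∀ z i → length z < i + length w → ¬ OA z i
  overrun z i lt (l , _) = <⇒≱ lt l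

  pending-[] : Lang S w → Pending []
  pending-[] h = subst (Lang S) (sym (++-identityʳ w)) h ,
    λ { (i , o) → overrun (w' ++ []) i (≤-trans (s≤s (≤-reflexive (cong length (++-identityʳ w')))) (m≤n+m _ i)) o }

  pending-prefix : ∀ u v → Pending (u ++ v) → Pending u
  pending-prefix u v (h , none) = Lang-++ˡ (w ++ u) v (subst (Lang S) (sym (++-assoc w u v)) h) ,
    λ { (i , o) → none (i , subst (λ z → OA z i) (++-assoc w' u v) (occurs-++ʳ (w' ++ u) v i o)) }

  new-occurrence : ∀ u b i → ¬ Occurs (w' ++ u) → OA (w' ++ u ++ [ b ]) i → i ≡ length u
  new-occurrence u b i none o with (i + length w) ≤? length (w' ++ u)
  ... | yes fits = ⊥-elim (none (i , occurs-++ʳ⁻ (w' ++ u) [ b ] i (subst (λ z → OA z i) (sym (++-assoc w' u [ b ])) o) fits))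
  ... | no ¬fits = ≤-antisym upper lower
    where
      open ≤-Reasoning
      upper : i ≤ length u
      upper = +-cancelʳ-≤ (length w') i (length u) (≤-pred (begin
        suc (i + length w')              ≡⟨ sym (+-suc i (length w')) ⟩
        i + length w                     ≤⟨ proj₁ o ⟩
        length (w' ++ u ++ [ b ])        ≡⟨ length-++ w' ⟩
        length w' + length (u ++ [ b ])  ≡⟨ cong (length w' +_) (length-snoc u b) ⟩
        length w' + suc (length u)       ≡⟨ +-suc (length w') (length u) ⟩
        suc (length w' + length u)       ≡⟨ cong suc (+-comm (length w') (length u)) ⟩
        suc (length u + length w')       ∎))
      lower : length u ≤ i
      lower = +-cancelʳ-≤ (length w') (length u) i (≤-pred (begin
        suc (length u + length w')       ≡⟨ cong suc (+-comm (length u) (length w')) ⟩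
        suc (length w' + length u)       ≡⟨ cong suc (sym (length-++ w')) ⟩
        suc (length (w' ++ u))           ≤⟨ ≰⇒> ¬fits ⟩
        i + length w                     ≡⟨ +-suc i (length w') ⟩
        suc (i + length w')              ∎))

  -- wub ends with w
  EndsWithW : Word k → Fin k → Set
  EndsWithW u b = OA (w' ++ u ++ [ b ]) (length u)

  length-return : ∀ u b → length (w ++ u ++ [ b ]) ∸ length w ≡ suc (length u)
  length-return u b = trans (cong (_∸ length w) (length-++ w))
                            (trans (m+n∸m≡n (length w) (length (u ++ [ b ]))) (length-snoc u b))

  return-intro : ∀ u b → Pending u → Lang S (w ++ u ++ [ b ]) → EndsWithW u b → Return S w (u ++ [ b ])
  return-intro u b (_ , none) h suffix = h , longer , occurs-prefix (u ++ [ b ]) ,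
      subst (OA (w ++ u ++ [ b ])) (sym (length-return u b)) (occurs-∷⁻ c (w' ++ u ++ [ b ]) (length u) suffix) ,
      only-two
    where
      longer : length w < length (w ++ u ++ [ b ])
      longer = ≤-trans (m<m+n (length w) (≤-trans (s≤s z≤n) (≤-reflexive (sym (length-snoc u b)))))
                       (≤-reflexive (sym (length-++ w)))
      only-two : ∀ i → OA (w ++ u ++ [ b ]) i → (i ≡ 0) ⊎ (i ≡ length (w ++ u ++ [ b ]) ∸ length w)
      only-two zero    o = inj₁ refl
      only-two (suc i) o = inj₂ (trans (cong suc (new-occurrence u b i none (occurs-∷ c _ i o))) (sym (length-return u b)))

  pending-intro : ∀ u b → Pending u → Lang S (w ++ u ++ [ b ]) → ¬ EndsWithW u b → Pending (u ++ [ b ])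
  pending-intro u b (_ , none) h ¬suffix =
    h , λ { (i , o) → ¬suffix (subst (OA (w' ++ u ++ [ b ])) (new-occurrence u b i none o) o) }

  return-elim : ∀ u b → Return S w (u ++ [ b ]) → Pending u × Lang S (w ++ u ++ [ b ]) × EndsWithW u b
  return-elim u b (h , _ , _ , o-end , only-two) =
    (Lang-++ˡ (w ++ u) [ b ] (subst (Lang S) (sym (++-assoc w u [ b ])) h) , none) , h ,
    occurs-∷ c (w' ++ u ++ [ b ]) (length u) (subst (OA (w ++ u ++ [ b ])) (length-return u b) o-end)
    where
      -- an inner occurrence would lie strictly between the two allowed ones
      none : ¬ Occurs (w' ++ u)
      none (i , o) with only-two (suc i) (occurs-∷⁻ c _ i (subst (λ z → OA z i) (++-assoc w' u [ b ]) (occurs-++ʳ (w' ++ u) [ b ] i o)))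
      ... | inj₁ ()
      ... | inj₂ e = overrun (w' ++ u) (length u) too-long (subst (OA (w' ++ u)) (suc-injective (trans e (length-return u b))) o)
        where
          too-long : length (w' ++ u) < length u + length w
          too-long = ≤-trans (s≤s (≤-reflexive (trans (length-++ w') (+-comm (length w') (length u)))))
                             (≤-reflexive (sym (+-suc (length u) (length w'))))

  pending-elim : ∀ u b → Pending (u ++ [ b ]) → Pending u × Lang S (w ++ u ++ [ b ]) × ¬ EndsWithW u b
  pending-elim u b p = pending-prefix u [ b ] p , proj₁ p , λ s → proj₂ p (length u , s)

  step-count : ∀ u b → ind (Return S w (u ++ [ b ])) + ind (Pending (u ++ [ b ])) ≡ ind (Pending u) * ind (Lang S (w ++ u ++ [ b ]))
  step-count u b =
    trans (sym (ind-⊎ _ _ (λ r p → proj₂ (proj₂ (pending-elim u b p)) (proj₂ (proj₂ (return-elim u b r))))))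
          (trans (ind-iff forward backward) (ind-× _ _))
    where
      forward : Return S w (u ++ [ b ]) ⊎ Pending (u ++ [ b ]) → Pending u × Lang S (w ++ u ++ [ b ])
      forward (inj₁ r) = proj₁ (return-elim u b r) , proj₁ (proj₂ (return-elim u b r))
      forward (inj₂ p) = proj₁ (pending-elim u b p) , proj₁ (proj₂ (pending-elim u b p))
      backward : Pending u × Lang S (w ++ u ++ [ b ]) → Return S w (u ++ [ b ]) ⊎ Pending (u ++ [ b ])
      backward (p , h) with LEM (EndsWithW u b)
      ... | yes s = inj₁ (return-intro u b p h s)
      ... | no ¬s = inj₂ (pending-intro u b p h ¬s)

  no-empty-return : ¬ Return S w []
  no-empty-return (_ , l , _) = 1+n≰n (≤-trans l (≤-reflexive (cong length (++-identityʳ w))))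

  return-snoc : ∀ x → Return S w x → Σ (Word k) λ u → Σ (Fin k) λ b → x ≡ u ++ [ b ] × Pending u
  return-snoc x r with initLast x
  ... | []       = ⊥-elim (no-empty-return r)
  ... | u ∷ʳ′ b  = u , b , refl , proj₁ (return-elim u b r)

  later-occurrence : ∀ y → Occurs (w' ++ y) →
    Σ (Word k) λ y' → Σ (Word k) λ pre → w ++ y ≡ pre ++ w ++ y' × length y' < length y
  later-occurrence y (i , o) = y' , c ∷ take i (w' ++ y) , cong (c ∷_) (occurs-decompose (w' ++ y) i o) , shorter
    where
      y' = drop (i + length w) (w' ++ y)
      open ≤-Reasoning
      shorter : suc (length y') ≤ length y
      shorter = +-cancelʳ-≤ (length w') (suc (length y')) (length y) (begin
        suc (length y') + length w'             ≡⟨ sym (+-suc (length y') (length w')) ⟩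
        length y' + length w                    ≤⟨ +-monoʳ-≤ (length y') (m≤n+m (length w) i) ⟩
        length y' + (i + length w)              ≡⟨ cong (_+ (i + length w)) (length-drop (i + length w) (w' ++ y)) ⟩
        length (w' ++ y) ∸ (i + length w) + (i + length w) ≡⟨ m∸n+n≡m (proj₁ o) ⟩
        length (w' ++ y)                        ≡⟨ length-++ w' ⟩
        length w' + length y                    ≡⟨ +-comm (length w') (length y) ⟩
        length y + length w'                    ∎)

  last-occurrence : ∀ y → Lang S (w ++ y) → Σ (Word k) λ u → Pending u × Σ (Word k) λ pre → w ++ y ≡ pre ++ w ++ u
  last-occurrence y = go (length y) y ≤-refl
    where
      go : ∀ n y → length y ≤ n → Lang S (w ++ y) → Σ (Word k) λ u → Pending u × Σ (Word k) λ pre → w ++ y ≡ pre ++ w ++ u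
      go n y ly h with LEM (Occurs (w' ++ y))
      ... | no none = y , (h , none) , [] , refl
      ... | yes occ with later-occurrence y occ
      ...   | y' , pre , e , shorter with n
      ...     | zero  = ⊥-elim (1+n≰n (≤-trans shorter (≤-trans ly z≤n)))
      ...     | suc n with go n y' (≤-pred (≤-trans shorter ly)) (Lang-++ʳ pre (w ++ y') (subst (Lang S) e h))
      ...       | u , p , pre' , e' = u , p , pre ++ pre' ,
                  trans e (trans (cong (pre ++_) e') (sym (++-assoc pre pre' (w ++ u))))

  pending-bounded : ∀ bd → (∀ z → Lang S z → bd < length z → Occurs z) → ∀ u → Pending u → length u ≤ bd
  pending-bounded bd long-occurs u (h , none) with length u ≤? bd
  ... | yes short = short
  ... | no  long  = ⊥-elim (none (long-occurs (w' ++ u) (Lang-tail c (w' ++ u) h)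
                                   (≤-trans (≰⇒> long) (length-++-≤ʳ u {w'}))))

  returns-bounded : ∀ bd → (∀ u → Pending u → length u ≤ bd) → ∀ x → Return S w x → length x ≤ suc bd
  returns-bounded bd short x r with return-snoc x r
  ... | u , b , refl , p = ≤-trans (≤-reflexive (length-snoc u b)) (s≤s (short u p))

module Rho (LEM : (P : Set) → Dec P) {k : ℕ} (S : ShiftSpace k) where
  open Classical LEM
  open WordSums k
  open Factors S

  deg : Word k → ℕ
  deg u = Σf (λ b → ind (Lang S (u ++ [ b ])))

  ρ : Word k → ℕ
  ρ u = deg u ∸ 1

  deg-∉ : ∀ u → ¬ Lang S u → deg u ≡ 0
  deg-∉ u ¬h = Σf-zero _ (λ b → ind-no (λ h → ¬h (Lang-++ˡ u [ b ] h)))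

  ρ-∉ : ∀ u → ¬ Lang S u → ρ u ≡ 0
  ρ-∉ u ¬h = cong (_∸ 1) (deg-∉ u ¬h)

  -- a factor has at least one right extension
  deg-ρ : ∀ u → deg u ≡ ρ u + ind (Lang S u)
  deg-ρ u with LEM (Lang S u)
  ... | yes h = sym (m∸n+n≡m (≤-trans (≤-reflexive (sym (ind-yes (proj₂ (Lang-snoc u h))))) (Σf-≥ _ (proj₁ (Lang-snoc u h)))))
  ... | no ¬h = trans (deg-∉ u ¬h) (sym (cong (_+ 0) (ρ-∉ u ¬h)))

  -- ρ is additive over left extensions of a word whose extension graph is a tree:
  -- Σ_a (deg(av) - 1) = #edges - #left vertices = #right vertices - 1
  ρ-additive : ∀ v → (Lang S v → IsTree S v) → Σf (λ a → ρ (a ∷ v)) ≡ ρ v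
  ρ-additive v tree with LEM (Lang S v)
  ... | no ¬h = trans (Σf-zero _ (λ a → ρ-∉ (a ∷ v) (λ h → ¬h (Lang-tail a v h)))) (sym (ρ-∉ v ¬h))
  ... | yes h = trans (sym (m+n∸n≡m X 1)) (cong (_∸ 1) (+-cancelʳ-≡ left (X + 1) (deg v) counted))
    where
      open TreeCount LEM S v (tree h) h using (tree-count)
      X    = Σf (λ a → ρ (a ∷ v))
      left = Σf (λ a → ind (Lang S (a ∷ v)))
      open ≡-Reasoning
      counted : (X + 1) + left ≡ deg v + left
      counted = begin
        (X + 1) + left
          ≡⟨ right-comm X 1 left ⟩
        (X + left) + 1
          ≡⟨ cong (_+ 1) (sym (Σl-+ (allFin k) _ _)) ⟩
        Σf (λ a → ρ (a ∷ v) + ind (Lang S (a ∷ v))) + 1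
          ≡⟨ cong (_+ 1) (sym (Σl-ext (allFin k) (λ a → deg-ρ (a ∷ v)))) ⟩
        Σf (λ a → deg (a ∷ v)) + 1
          ≡⟨ tree-count ⟩
        left + deg v
          ≡⟨ +-comm left (deg v) ⟩
        deg v + left ∎

module Constancy (LEM : (P : Set) → Dec P) {k : ℕ} (S : ShiftSpace k) (m : ℕ) (ed : EventuallyDendric S m) where
  open WordSums k
  open Rho LEM S

  P : ℕ → ℕ
  P N = ΣW N ρ

  P-step : ∀ N → m ≤ N → P (suc N) ≡ P N
  P-step N m≤N = trans (sym (ΣW-swap N (λ a x → ρ (a ∷ x))))
                       (ΣW-ext N (λ x lx → ρ-additive x (λ h → ed x h (≤-trans m≤N (≤-reflexive (sym lx))))))

  P-constant : ∀ N → m ≤ N → P N ≡ P m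
  P-constant N m≤N = trans (cong P (sym (m+[n∸m]≡n m≤N))) (go (N ∸ m))
    where
      go : ∀ j → P (m + j) ≡ P m
      go zero    = cong P (+-identityʳ m)
      go (suc j) = trans (cong P (+-suc m j)) (trans (P-step (m + j) (m≤m+n m j)) (go j))

module ReturnCount (LEM : (P : Set) → Dec P) {k : ℕ} (S : ShiftSpace k) (m : ℕ)
                   (irr : Irreducible S) (ed : EventuallyDendric S m)
                   (c : Fin k) (w' : Word k) (Lw : Lang S (c ∷ w')) (m≤|w| : m ≤ suc (length w')) where
  open Classical LEM
  open Letters k
  open WordSums k
  open Factors S
  open Rho LEM S
  open Constancy LEM S m ed
  open ReturnWords LEM S c w'

  Mass : ℕ → ℕ
  Mass N = ΣW N (λ z → ind (Occurs z) * ρ z)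

  -- the ρ-weight of x when w occurs in x only as a prefix
  ρ-first : Word k → ℕ
  ρ-first x = ind (OA x 0 × ¬ Occurs (drop 1 x)) * ρ x

  PendingMass : ℕ → ℕ
  PendingMass j = ΣW j (λ u → ρ-first (w ++ u))

  occurs-∷-split : ∀ a z → ind (Occurs (a ∷ z)) ≡ ind (Occurs z) + ind (OA (a ∷ z) 0 × ¬ Occurs z)
  occurs-∷-split a z = trans (ind-iff to from) (ind-⊎ _ _ (λ o only → proj₂ only o))
    where
      to : Occurs (a ∷ z) → Occurs z ⊎ (OA (a ∷ z) 0 × ¬ Occurs z)
      to (zero , o) with LEM (Occurs z)
      ... | yes oz = inj₁ oz
      ... | no ¬oz = inj₂ (o , ¬oz)
      to (suc i , o) = inj₁ (i , occurs-∷ a z i o)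
      from : Occurs z ⊎ (OA (a ∷ z) 0 × ¬ Occurs z) → Occurs (a ∷ z)
      from (inj₁ (i , o)) = suc i , occurs-∷⁻ a z i o
      from (inj₂ (o , _)) = 0 , o

  -- words containing w are long enough for ρ to be additive on them
  additive-if-occurs : ∀ z → ind (Occurs z) * Σf (λ a → ρ (a ∷ z)) ≡ ind (Occurs z) * ρ z
  additive-if-occurs z = by-cases (LEM (Occurs z))
    where
      by-cases : Dec (Occurs z) → ind (Occurs z) * Σf (λ a → ρ (a ∷ z)) ≡ ind (Occurs z) * ρ z
      by-cases (yes (i , o)) = cong (ind (Occurs z) *_) (ρ-additive z (λ h → ed z h (≤-trans m≤|w| (occurs-length z i o))))
      by-cases (no ¬o) = trans (cong (_* Σf (λ a → ρ (a ∷ z))) (ind-no ¬o)) (cong (_* ρ z) (sym (ind-no ¬o)))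

  mass-step : ∀ N → Mass (suc N) ≡ Mass N + ΣW (suc N) ρ-first
  mass-step N = begin
    Mass (suc N)
      ≡⟨ Σl-ext (allFin k) (λ a → trans (ΣW-ext N (λ z _ → split a z)) (ΣW-+ N _ _)) ⟩
    Σf (λ a → ΣW N (λ z → ind (Occurs z) * ρ (a ∷ z)) + ΣW N (λ z → ρ-first (a ∷ z)))
      ≡⟨ Σl-+ (allFin k) _ _ ⟩
    Σf (λ a → ΣW N (λ z → ind (Occurs z) * ρ (a ∷ z))) + ΣW (suc N) ρ-first
      ≡⟨ cong (_+ ΣW (suc N) ρ-first) (sym (ΣW-swap N (λ a z → ind (Occurs z) * ρ (a ∷ z)))) ⟩
    ΣW N (λ z → Σf (λ a → ind (Occurs z) * ρ (a ∷ z))) + ΣW (suc N) ρ-first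
      ≡⟨ cong (_+ ΣW (suc N) ρ-first) (ΣW-ext N (λ z _ →
           trans (Σl-*ˡ (allFin k) (ind (Occurs z)) (λ a → ρ (a ∷ z))) (additive-if-occurs z))) ⟩
    Mass N + ΣW (suc N) ρ-first ∎
    where
      open ≡-Reasoning
      split : ∀ a z → ind (Occurs (a ∷ z)) * ρ (a ∷ z) ≡ ind (Occurs z) * ρ (a ∷ z) + ρ-first (a ∷ z)
      split a z = trans (cong (_* ρ (a ∷ z)) (occurs-∷-split a z))
                        (*-distribʳ-+ (ρ (a ∷ z)) (ind (Occurs z)) _)

  short-mass : ∀ N → N < length w → Mass N ≡ 0
  short-mass N l = ΣW-zero N _ (λ x lx → cong (_* ρ x)
    (ind-no (λ { (i , o) → <-irrefl refl (≤-trans l (≤-trans (occurs-length x i o) (≤-reflexive lx))) })))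

  -- a word with w as a prefix is w ++ u
  first-mass : ∀ j → ΣW (length w + j) ρ-first ≡ PendingMass j
  first-mass j = trans (ΣW-split (length w) j ρ-first)
    (ΣW-point (λ p → ΣW j (λ u → ρ-first (p ++ u))) w
      (λ p lp p≢w → ΣW-zero j _ (λ u _ → cong (_* ρ (p ++ u)) (ind-no (λ { (o , _) →
        p≢w (trans (sym (take-++-length p u)) (trans (cong (λ n → take n (p ++ u)) lp) (proj₂ o))) })))))

  mass-pending : ∀ j → Mass (length w + j) ≡ Σ< (suc j) PendingMass
  mass-pending zero    = trans (mass-step (length w' + 0))
    (cong₂ _+_ (short-mass (length w' + 0) (s≤s (≤-reflexive (+-identityʳ _)))) (first-mass 0))
  mass-pending (suc j) = trans (cong Mass (+-suc (length w) j))
    (trans (mass-step (length w + j))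
           (cong₂ _+_ (mass-pending j) (trans (cong (λ n → ΣW n ρ-first) (sym (+-suc (length w) j))) (first-mass (suc j)))))

  mass≤P : ∀ N → Mass N ≤ P N
  mass≤P N = ΣW-mono N (λ z → ≤-trans (*-monoˡ-≤ (ρ z) (ind≤1 (Occurs z))) (≤-reflexive (+-identityʳ (ρ z))))

  pending-mass-bounded : ∀ j → Σ< j PendingMass ≤ P m
  pending-mass-bounded zero    = z≤n
  pending-mass-bounded (suc j) = begin
    Σ< (suc j) PendingMass   ≡⟨ sym (mass-pending j) ⟩
    Mass (length w + j)      ≤⟨ mass≤P (length w + j) ⟩
    P (length w + j)         ≡⟨ P-constant (length w + j) (≤-trans m≤|w| (m≤m+n _ j)) ⟩
    P m                      ∎
    where open ≤-Reasoning

  pending-mass-eventually-zero : Σ ℕ λ J → ∀ i → J ≤ i → PendingMass i ≡ 0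
  pending-mass-eventually-zero = eventually-zero (P m) PendingMass pending-mass-bounded

  J : ℕ
  J = proj₁ pending-mass-eventually-zero

  ρ-vanishes : ∀ u → J ≤ length u → Pending u → ρ (w ++ u) ≡ 0
  ρ-vanishes u J≤|u| (_ , none) = begin
    ρ (w ++ u)                 ≡⟨ sym (+-identityʳ _) ⟩
    1 * ρ (w ++ u)             ≡⟨ cong (_* ρ (w ++ u)) (sym (ind-yes (occurs-prefix u , none))) ⟩
    ρ-first (w ++ u)           ≡⟨ ΣW-zero⁻ (length u) _ (proj₂ pending-mass-eventually-zero (length u) J≤|u|) u refl ⟩
    0                          ∎
    where open ≡-Reasoning

  unique-extension : ∀ u → J ≤ length u → Pending u → ∀ b b' →
                     Lang S ((w ++ u) ++ [ b ]) → Lang S ((w ++ u) ++ [ b' ]) → b ≡ b'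
  unique-extension u J≤|u| p = Σf-unique (λ b → Lang S ((w ++ u) ++ [ b ]))
    (≤-trans (≤-reflexive (trans (deg-ρ (w ++ u)) (cong (_+ ind (Lang S (w ++ u))) (ρ-vanishes u J≤|u| p)))) (ind≤1 _))

  forced : ∀ q y₁ y₂ → J ≤ length q → Lang S (w ++ q ++ y₁) → Pending (q ++ y₂) → length y₁ ≤ length y₂ →
           Σ (Word k) λ r → y₂ ≡ y₁ ++ r
  forced q []       y₂        J≤|q| h p l       = y₂ , refl
  forced q (e ∷ y₁) (e' ∷ y₂) J≤|q| h p (s≤s l)
    with unique-extension q J≤|q| (pending-prefix q (e' ∷ y₂) p) e e'
           (Lang-++ˡ ((w ++ q) ++ [ e ]) y₁ (subst (Lang S) (regroup q e y₁) h))
           (Lang-++ˡ ((w ++ q) ++ [ e' ]) y₂ (subst (Lang S) (regroup q e' y₂) (proj₁ p)))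
    where
      regroup : ∀ q e y → w ++ q ++ e ∷ y ≡ ((w ++ q) ++ [ e ]) ++ y
      regroup q e y = sym (trans (++-assoc (w ++ q) [ e ] y) (++-assoc w q (e ∷ y)))
  ... | refl with forced (q ++ [ e ]) y₁ y₂ (≤-trans J≤|q| (length-++-≤ˡ q))
                    (subst (Lang S) (cong (w ++_) (sym (++-assoc q [ e ] y₁))) h)
                    (subst Pending (sym (++-assoc q [ e ] y₂)) p) l
  ... | r , y₂≡y₁r = r , cong (e ∷_) y₂≡y₁r

  -- by irreducibility each factor w u₀ is followed by some t and then w again
  bridge : Word k → Word k
  bridge u₀ = choose (LEM (Lang S (w ++ u₀)))
    where
      choose : Dec (Lang S (w ++ u₀)) → Word k
      choose (yes h) = proj₁ (irr (w ++ u₀) w h Lw)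
      choose (no  _) = []

  bridge-spec : ∀ u₀ → Lang S (w ++ u₀) → Lang S ((w ++ u₀) ++ bridge u₀ ++ w)
  bridge-spec u₀ h with LEM (Lang S (w ++ u₀))
  ... | yes h' = proj₂ (irr (w ++ u₀) w h' Lw)
  ... | no ¬h  = ⊥-elim (¬h h)

  D : ℕ
  D = J + ΣW J (λ u₀ → length (bridge u₀ ++ w))

  -- a pending u₀ y with |u₀| = J and y long would contain the forced next occurrence of w
  pending-runs-into-w : ∀ u₀ y → length u₀ ≡ J → Pending (u₀ ++ y) → length (bridge u₀ ++ w) ≤ length y →
                        Occurs (w' ++ u₀ ++ y)
  pending-runs-into-w u₀ y |u₀|≡J p l with forced u₀ (bridge u₀ ++ w) y (≤-reflexive (sym |u₀|≡J))
      (subst (Lang S) (++-assoc w u₀ (bridge u₀ ++ w)) (bridge-spec u₀ (proj₁ (pending-prefix u₀ y p)))) p l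
  ... | r , refl = length (w' ++ u₀ ++ t) , subst (λ z → OA z (length (w' ++ u₀ ++ t))) (sym regroup)
                                                  (occurs-middle (w' ++ u₀ ++ t) r)
    where
      t = bridge u₀
      regroup : w' ++ u₀ ++ (t ++ w) ++ r ≡ (w' ++ u₀ ++ t) ++ w ++ r
      regroup = begin
        w' ++ u₀ ++ (t ++ w) ++ r     ≡⟨ cong (λ q → w' ++ u₀ ++ q) (++-assoc t w r) ⟩
        w' ++ u₀ ++ t ++ w ++ r       ≡⟨ cong (w' ++_) (sym (++-assoc u₀ t (w ++ r))) ⟩
        w' ++ (u₀ ++ t) ++ w ++ r     ≡⟨ sym (++-assoc w' (u₀ ++ t) (w ++ r)) ⟩
        (w' ++ u₀ ++ t) ++ w ++ r     ∎
        where open ≡-Reasoning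

  pending-short : ∀ u → Pending u → length u ≤ D
  pending-short u p with length u ≤? D
  ... | yes short = short
  ... | no  long  = ⊥-elim (proj₂ p (subst (λ z → Occurs (w' ++ z)) (take++drop≡id J u)
                      (pending-runs-into-w u₀ y (length-take≤ J u J≤|u|) (subst Pending (sym (take++drop≡id J u)) p) room)))
    where
      u₀ = take J u
      y  = drop J u
      J≤|u| : J ≤ length u
      J≤|u| = ≤-trans (m≤m+n J _) (<⇒≤ (≰⇒> long))
      open ≤-Reasoning
      room : length (bridge u₀ ++ w) ≤ length y
      room = begin
        length (bridge u₀ ++ w)                     ≤⟨ ΣW-≥ J (λ u₀ → length (bridge u₀ ++ w)) u₀ (length-take≤ J u J≤|u|) ⟩
        ΣW J (λ u₀ → length (bridge u₀ ++ w))       ≡⟨ sym (m+n∸m≡n J _) ⟩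
        D ∸ J                                       ≤⟨ ∸-monoˡ-≤ J (<⇒≤ (≰⇒> long)) ⟩
        length u ∸ J                                ≡⟨ sym (length-drop J u) ⟩
        length y                                    ∎

  -- every factor longer than |w| + D contains w: it ends a word w t z whose last occurrence of w lies inside z
  long-factors-contain : ∀ z → Lang S z → length w + D < length z → Occurs z
  long-factors-contain z hz long with irr w z Lw hz
  ... | t , h with last-occurrence (t ++ z) h
  ... | u , p , pre , e with suffix (w ++ t) z pre (w ++ u) (trans (++-assoc w t z) e)
        (≤-trans (≤-reflexive (length-++ w)) (≤-trans (+-monoʳ-≤ (length w) (pending-short u p)) (<⇒≤ long)))
  ... | z₀ , refl = length z₀ , occurs-middle z₀ u

  Returns : ℕ → ℕ
  Returns i = ΣW i (λ x → ind (Return S w x))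

  Pendings : ℕ → ℕ
  Pendings i = ΣW i (λ x → ind (Pending x))

  pending-weight : ∀ u → ind (Pending u) * (ρ (w ++ u) + ind (Lang S (w ++ u))) ≡ ρ-first (w ++ u) + ind (Pending u)
  pending-weight u = by-cases (LEM (Pending u)) (LEM (Lang S (w ++ u)))
    where
      by-cases : Dec (Pending u) → Dec (Lang S (w ++ u)) →
                 ind (Pending u) * (ρ (w ++ u) + ind (Lang S (w ++ u))) ≡ ρ-first (w ++ u) + ind (Pending u)
      by-cases (yes p) _ rewrite ind-yes p | ind-yes (proj₁ p)
                               | ind-yes {P = OA (w ++ u) 0 × ¬ Occurs (w' ++ u)} (occurs-prefix u , proj₂ p) =
        trans (+-identityʳ _) (cong (_+ 1) (sym (+-identityʳ _)))
      by-cases (no ¬p) (yes h) rewrite ind-no ¬p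
                               | ind-no {P = OA (w ++ u) 0 × ¬ Occurs (w' ++ u)} (λ { (_ , none) → ¬p (h , none) }) = refl
      by-cases (no ¬p) (no ¬h) rewrite ind-no ¬p | ρ-∉ (w ++ u) ¬h =
        sym (trans (+-identityʳ _) (*-zeroʳ (ind (OA (w ++ u) 0 × ¬ Occurs (w' ++ u)))))

  -- summing the one-letter step over all pending words of length i
  level : ∀ i → Returns (suc i) + Pendings (suc i) ≡ PendingMass i + Pendings i
  level i = begin
    Returns (suc i) + Pendings (suc i)
      ≡⟨ sym (ΣW-+ (suc i) (λ x → ind (Return S w x)) (λ x → ind (Pending x))) ⟩
    ΣW (suc i) (λ x → ind (Return S w x) + ind (Pending x))
      ≡⟨ ΣW-snoc i (λ x → ind (Return S w x) + ind (Pending x)) ⟩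
    ΣW i (λ u → Σf (λ b → ind (Return S w (u ++ [ b ])) + ind (Pending (u ++ [ b ]))))
      ≡⟨ ΣW-ext i (λ u _ → Σl-ext (allFin k) (λ b → step-count u b)) ⟩
    ΣW i (λ u → Σf (λ b → ind (Pending u) * ind (Lang S (w ++ u ++ [ b ]))))
      ≡⟨ ΣW-ext i (λ u _ → trans (Σl-*ˡ (allFin k) (ind (Pending u)) _)
                                 (cong (ind (Pending u) *_)
                                       (Σl-ext (allFin k) (λ b → cong (ind ∘ Lang S) (sym (++-assoc w u [ b ])))))) ⟩
    ΣW i (λ u → ind (Pending u) * deg (w ++ u))
      ≡⟨ ΣW-ext i (λ u _ → trans (cong (ind (Pending u) *_) (deg-ρ (w ++ u))) (pending-weight u)) ⟩
    ΣW i (λ u → ρ-first (w ++ u) + ind (Pending u))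
      ≡⟨ ΣW-+ i (λ u → ρ-first (w ++ u)) (λ u → ind (Pending u)) ⟩
    PendingMass i + Pendings i ∎
    where open ≡-Reasoning

  pendings-vanish : Pendings (suc D) ≡ 0
  pendings-vanish = ΣW-zero (suc D) _ (λ x lx → ind-no (λ p → 1+n≰n (≤-trans (≤-reflexive (sym lx)) (pending-short x p))))

  pending-mass-vanishes : PendingMass (suc D) ≡ 0
  pending-mass-vanishes = ΣW-zero (suc D) _ (λ u lu → by-cases u lu (LEM (Lang S (w ++ u))))
    where
      by-cases : ∀ u → length u ≡ suc D → Dec (Lang S (w ++ u)) → ρ-first (w ++ u) ≡ 0
      by-cases u lu (yes h) = cong (_* ρ (w ++ u)) (ind-no (λ { (_ , none) →
                                1+n≰n (≤-trans (≤-reflexive (sym lu)) (pending-short u (h , none))) }))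
      by-cases u lu (no ¬h) = trans (cong (ind (OA (w ++ u) 0 × ¬ Occurs (w' ++ u)) *_) (ρ-∉ (w ++ u) ¬h))
                                    (*-zeroʳ (ind (OA (w ++ u) 0 × ¬ Occurs (w' ++ u))))

  mass-everything : ∀ N → length w + D < N → Mass N ≡ P N
  mass-everything N long = ΣW-ext N (λ z lz → by-cases z lz (LEM (Lang S z)))
    where
      by-cases : ∀ z → length z ≡ N → Dec (Lang S z) → ind (Occurs z) * ρ z ≡ ρ z
      by-cases z lz (yes h) = trans (cong (_* ρ z) (ind-yes (long-factors-contain z h (≤-trans long (≤-reflexive (sym lz))))))
                                    (+-identityʳ _)
      by-cases z lz (no ¬h) = trans (cong (ind (Occurs z) *_) (ρ-∉ z ¬h)) (trans (*-zeroʳ (ind (Occurs z))) (sym (ρ-∉ z ¬h)))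

  pending-mass-total : Σ< (suc D) PendingMass ≡ P m
  pending-mass-total = begin
    Σ< (suc D) PendingMass                               ≡⟨ sym (+-identityʳ _) ⟩
    Σ< (suc D) PendingMass + 0                           ≡⟨ cong (Σ< (suc D) PendingMass +_) (sym pending-mass-vanishes) ⟩
    Σ< (suc (suc D)) PendingMass                         ≡⟨ sym (mass-pending (suc D)) ⟩
    Mass (length w + suc D)                              ≡⟨ mass-everything _ (≤-reflexive (sym (+-suc (length w) D))) ⟩
    P (length w + suc D)                                 ≡⟨ P-constant _ (≤-trans m≤|w| (m≤m+n _ _)) ⟩
    P m                                                  ∎
    where open ≡-Reasoning

  returns-total : Σ< (suc (suc D)) Returns ≡ suc (P m)
  returns-total = begin
    Σ< (suc (suc D)) Returns                ≡⟨ Σ<-shift (suc D) Returns ⟩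
    Returns 0 + Σ< (suc D) later            ≡⟨ cong (_+ Σ< (suc D) later) (ind-no no-empty-return) ⟩
    Σ< (suc D) later                        ≡⟨ sym (+-identityʳ _) ⟩
    Σ< (suc D) later + 0                    ≡⟨ cong (Σ< (suc D) later +_) (sym pendings-vanish) ⟩
    Σ< (suc D) later + Pendings (suc D)     ≡⟨ telescope (suc D) Returns Pendings PendingMass level ⟩
    Σ< (suc D) PendingMass + Pendings 0     ≡⟨ cong₂ _+_ pending-mass-total (ind-yes (pending-[] Lw)) ⟩
    P m + 1                                 ≡⟨ +-comm (P m) 1 ⟩
    suc (P m)                               ∎
    where
      open ≡-Reasoning
      later = λ i → Returns (suc i)

  -- return words are one letter longer than pending words
  returns-short : ∀ x → Return S w x → length x ≤ suc D
  returns-short = returns-bounded D pending-short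

module Enumeration (k : ℕ) where
  open WordSums k

  words : ℕ → List (Word k)
  words zero    = [ [] ]
  words (suc n) = cartesianProductWith _∷_ (allFin k) (words n)

  Σl-prepend : ∀ (as : List (Fin k)) (L : List (Word k)) f →
               Σl (cartesianProductWith _∷_ as L) f ≡ Σl as (λ a → Σl L (λ x → f (a ∷ x)))
  Σl-prepend []       L f = refl
  Σl-prepend (a ∷ as) L f = trans (Σl-++ (map (a ∷_) L) _ f) (cong₂ _+_ (Σl-map (a ∷_) L f) (Σl-prepend as L f))

  Σl-words : ∀ n f → Σl (words n) f ≡ ΣW n f
  Σl-words zero    f = +-identityʳ _
  Σl-words (suc n) f = trans (Σl-prepend (allFin k) (words n) f) (Σl-ext (allFin k) (λ a → Σl-words n _))

  words-complete : ∀ x → x ∈ words (length x)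
  words-complete []      = here refl
  words-complete (a ∷ x) = ∈-cartesianProductWith⁺ _∷_ (∈-allFin a) (words-complete x)

  words-length : ∀ n x → x ∈ words n → length x ≡ n
  words-length zero    x (here refl) = refl
  words-length (suc n) y m with ∈-cartesianProductWith⁻ _∷_ (allFin k) (words n) m
  ... | a , x , _ , mx , refl = cong suc (words-length n x mx)

  words-unique : ∀ n → Unique (words n)
  words-unique zero    = All.[] ∷ []
  words-unique (suc n) = cartesianProductWith⁺ _∷_ ∷-injective (allFin⁺ k) (words-unique n)

  shorter : ℕ → List (Word k)
  shorter zero    = []
  shorter (suc j) = shorter j ++ words j

  shorter-complete : ∀ j x → length x < j → x ∈ shorter j
  shorter-complete (suc j) x l with m≤n⇒m<n∨m≡n (≤-pred l)
  ... | inj₁ l'   = ∈-++⁺ˡ (shorter-complete j x l')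
  ... | inj₂ refl = ∈-++⁺ʳ (shorter j) (words-complete x)

  shorter-length : ∀ j x → x ∈ shorter j → length x < j
  shorter-length (suc j) x m with ∈-++⁻ (shorter j) m
  ... | inj₁ m' = ≤-trans (shorter-length j x m') (n≤1+n j)
  ... | inj₂ m' = s≤s (≤-reflexive (words-length j x m'))

  shorter-unique : ∀ j → Unique (shorter j)
  shorter-unique zero    = []
  shorter-unique (suc j) = ++⁺ (shorter-unique j) (words-unique j)
    (λ { (m , m') → <-irrefl (words-length j _ m') (shorter-length j _ m) })

  Σl-shorter : ∀ j f → Σl (shorter j) f ≡ Σ< j (λ i → ΣW i f)
  Σl-shorter zero    f = refl
  Σl-shorter (suc j) f = trans (Σl-++ (shorter j) (words j) f) (cong₂ _+_ (Σl-shorter j f) (Σl-words j f))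

module Cardinality (LEM : (P : Set) → Dec P) {A : Set} where
  open Classical LEM

  select : (P : A → Set) → List A → List A
  select P = filter (λ x → LEM (P x))

  length-select : ∀ (P : A → Set) xs → length (select P xs) ≡ Σl xs (λ x → ind (P x))
  length-select P []       = refl
  length-select P (x ∷ xs) with LEM (P x)
  ... | yes _ = cong suc (length-select P xs)
  ... | no  _ = length-select P xs

  Σl-select : ∀ (P : A → Set) xs f → (∀ x → ¬ P x → f x ≡ 0) → Σl (select P xs) f ≡ Σl xs f
  Σl-select P []       f z = refl
  Σl-select P (x ∷ xs) f z with LEM (P x)
  ... | yes _ = cong (f x +_) (Σl-select P xs f z)
  ... | no ¬p = trans (Σl-select P xs f z) (sym (cong (_+ Σl xs f) (z x ¬p)))

  select-spec : ∀ (P : A → Set) U t → (P t → t ∈ U) → (P t → t ∈ select P U) × (t ∈ select P U → P t)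
  select-spec P U t inU = (λ p → ∈-filter⁺ (λ x → LEM (P x)) (inU p) p) ,
                          (λ m → proj₂ (∈-filter⁻ (λ x → LEM (P x)) {xs = U} m))

  card-within : (P : A → Set) (U : List A) → Unique U → (∀ t → P t → t ∈ U) → HasCard P (Σl U (λ x → ind (P x)))
  card-within P U unique inU =
    select P U , filter⁺ (λ x → LEM (P x)) unique , (λ t → select-spec P U t (inU t)) , length-select P U

module Theorem (LEM : (P : Set) → Dec P) {k : ℕ} (S : ShiftSpace k) (m : ℕ)
               (irr : Irreducible S) (ed : EventuallyDendric S m) where
  open Classical LEM
  open WordSums k
  open Factors S
  open Rho LEM S
  open Constancy LEM S m ed
  open Enumeration k
  open Cardinality LEM

  empty-return⇒ : ∀ u → Return S [] u → Lang S u × length u ≡ 1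
  empty-return⇒ u (h , l , _ , _ , only-two) with only-two 1 (≤-trans (≤-reflexive (+-identityʳ 1)) l , refl)
  ... | inj₁ ()
  ... | inj₂ e = h , sym e

  empty-return⇐ : ∀ a → Lang S [ a ] → Return S [] [ a ]
  empty-return⇐ a h = h , s≤s z≤n , (z≤n , refl) , (s≤s z≤n , refl) , only-two
    where
      only-two : ∀ i → OccursAt S [] [ a ] i → (i ≡ 0) ⊎ (i ≡ 1)
      only-two zero          _            = inj₁ refl
      only-two (suc zero)    _            = inj₂ refl
      only-two (suc (suc i)) (s≤s () , _)

  card-empty-returns : HasCard (Return S []) (deg [])
  card-empty-returns = subst (HasCard (Return S [])) count
    (card-within (Return S []) (words 1) (words-unique 1)
      (λ t r → subst (λ n → t ∈ words n) (proj₂ (empty-return⇒ t r)) (words-complete t)))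
    where
      count : Σl (words 1) (λ x → ind (Return S [] x)) ≡ deg []
      count = trans (Σl-words 1 _) (Σl-ext (allFin k) (λ a → ind-iff (λ r → proj₁ (empty-return⇒ [ a ] r)) (empty-return⇐ a)))

  rho-Lm : IsRhoLm S m (P m)
  rho-Lm = Lm , map deg Lm , (λ t → membership t) , filter⁺ (λ t → LEM (Lang S t)) (words-unique m) ,
           degrees Lm , total
    where
      Lm = select (Lang S) (words m)
      membership : ∀ t → (Lang= S m t → t ∈ Lm) × (t ∈ Lm → Lang= S m t)
      membership t = (λ { (h , refl) → proj₁ (select-spec (Lang S) (words m) t (λ _ → words-complete t)) h }) ,
                     (λ mt → proj₂ (∈-filter⁻ (λ t → LEM (Lang S t)) {xs = words m} mt) ,
                             words-length m t (proj₁ (∈-filter⁻ (λ t → LEM (Lang S t)) {xs = words m} mt)))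
      degrees : ∀ us → Pointwise (λ u n → HasCard (R₁ S u) n) us (map deg us)
      degrees []       = []
      degrees (u ∷ us) = card-within (R₁ S u) (allFin k) (allFin⁺ k) (λ b _ → ∈-allFin b) ∷ degrees us
      total : P m ≡ sum (map (_∸ 1) (map deg Lm))
      total = sym (trans (cong sum (sym (map-∘ Lm)))
                         (trans (Σl-select (Lang S) (words m) ρ ρ-∉) (Σl-words m ρ)))

  card-returns : ∀ w → Lang S w → m ≤ length w → HasCard (Return S w) (suc (P m))
  card-returns [] Lw z≤n = subst (HasCard (Return S [])) (trans (deg-ρ []) (trans (cong (ρ [] +_) (ind-yes Lw)) (+-comm (ρ []) 1)))
                                 card-empty-returns
  card-returns (c ∷ w') Lw m≤|w| =
    subst (HasCard (Return S (c ∷ w'))) (trans (Σl-shorter (suc (suc D)) _) returns-total)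
      (card-within (Return S (c ∷ w')) (shorter (suc (suc D))) (shorter-unique (suc (suc D)))
                   (λ t r → shorter-complete (suc (suc D)) t (s≤s (returns-short t r))))
    where open ReturnCount LEM S m irr ed c w' Lw m≤|w|

  -- first statement: pad w to a word wt of length ≥ m; long factors contain wt, hence w
  finite-returns : ∀ w → Lang S w → Finite (Return S w)
  finite-returns []       Lw = _ , card-empty-returns
  finite-returns (c ∷ w') Lw with Lang-extend (c ∷ w') m Lw
  ... | t , Lwt , |t|≡m = _ , card-within (Return S (c ∷ w')) (shorter (suc (suc bd))) (shorter-unique (suc (suc bd)))
                               (λ x r → shorter-complete (suc (suc bd)) x (s≤s (returns-bounded bd (pending-bounded bd long-occurs) x r)))
    where
      open ReturnWords LEM S c w' using (Occurs; occurs-shorten; pending-bounded; returns-bounded)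
      m≤|wt| : m ≤ suc (length (w' ++ t))
      m≤|wt| = ≤-trans (≤-reflexive (sym |t|≡m)) (≤-trans (length-++-≤ʳ t {w'}) (n≤1+n _))
      module Padded = ReturnCount LEM S m irr ed c (w' ++ t) Lwt m≤|wt|
      bd : ℕ
      bd = suc (length (w' ++ t)) + Padded.D
      long-occurs : ∀ z → Lang S z → bd < length z → Occurs z
      long-occurs z h l with Padded.long-factors-contain z h l
      ... | i , o = i , occurs-shorten t z i o

theorem7p3 : (LEM : (P : Set) → Dec P) → ∀ {k} (S : ShiftSpace k) (m : ℕ) →
    Irreducible S → EventuallyDendric S m →
    (∀ w → Lang S w → Finite (Return S w)) ×
    (∀ w → Lang S w → m ≤ length w →
      ∃[ r ] (IsRhoLm S m r × HasCard (Return S w) (suc r)))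
theorem7p3 LEM S m irr ed = finite-returns , λ w Lw m≤|w| → P m , rho-Lm , card-returns w Lw m≤|w|
  where
    open Theorem LEM S m irr ed
    open Constancy LEM S m ed using (P)
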